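{- For every integer $n\geq 3$, the cycle $C_n$ on $n$ vertices satisfies $b_{dR}(C_n)=1$ if $n\equiv 2$ or $n\equiv 4 \pmod 6$, and $b_{dR}(C_n)=2$ otherwise.
   Context: All graphs are finite, simple and undirected. For a graph $G=(V,E)$, a double Roman dominating function (DRDF) is a function $f:V\to\{0,1,2,3\}$ such that every vertex $v$ with $f(v)=0$ has at least two neighbors $u$ with $f(u)=2$ or at least one neighbor $w$ with $f(w)=3$, and every vertex $v$ with $f(v)=1$ has at least one neighbor $w$ with $f(w)\geq 2$. The weight of $f$ is $\sum_{u\in V}f(u)$, and $\gamma_{dR}(G)$ is the minimum weight of a DRDF on $G$. The double Roman bondage number $b_{dR}(G)$ of a graph $G$ with at least one edge is the minimum cardinality of an edge set $B\subseteq E(G)$ such that $\gamma_{dR}(G-B)>\gamma_{dR}(G)$, where $G-B$ is the spanning subgraph obtained by deleting the edges of $B$. -}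

module Defs where

open import Data.Nat using (ℕ; zero; suc; _+_; _≤_; _<_; _%_)
open import Data.Nat.Properties using (_≟_)
open import Data.Fin using (Fin; toℕ)
open import Data.Bool using (Bool; true; false; _∧_; _∨_; not; if_then_else_)
open import Data.Nat.ListAction using (sum)
open import Data.List using (List; map; length; filter; allFin; concatMap)
open import Data.Product using (Σ; _×_; _,_; ∃; ∃-syntax)
open import Data.Sum using (_⊎_)
open import Relation.Binary.PropositionalEquality using (_≡_; _≢_)
open import Relation.Nullary.Decidable using (⌊_⌋)

-- A (simple, undirected) graph on the vertex set Fin n, given by its
-- Boolean adjacency relation (only symmetric irreflexive ones are used).
Graph : ℕ → Set
Graph n = Fin n → Fin n → Bool

Adj : ∀ {n} → Graph n → Fin n → Fin n → Set
Adj G u v = G u v ≡ true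

IsDRDF : ∀ {n} → Graph n → (Fin n → ℕ) → Set
IsDRDF {n} G f =
  ((v : Fin n) → f v ≤ 3) ×
  ((v : Fin n) → f v ≡ 0 →
      (∃[ w ] (Adj G v w × f w ≡ 3))
    ⊎ (∃[ u ] ∃[ u' ] (u ≢ u' × Adj G v u × Adj G v u' × f u ≡ 2 × f u' ≡ 2))) ×
  ((v : Fin n) → f v ≡ 1 → ∃[ w ] (Adj G v w × 2 ≤ f w))

weight : ∀ {n} → (Fin n → ℕ) → ℕ
weight {n} f = sum (map f (allFin n))

IsγdR : ∀ {n} → Graph n → ℕ → Set
IsγdR G k = (∃[ f ] (IsDRDF G f × weight f ≡ k))
          × (∀ f → IsDRDF G f → k ≤ weight f)

IsEdgeSubset : ∀ {n} → Graph n → (Fin n → Fin n → Bool) → Set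
IsEdgeSubset G B = (∀ u v → B u v ≡ B v u) × (∀ u v → B u v ≡ true → G u v ≡ true)

-- |B| : number of unordered pairs {u,v} (u < v) with B u v
card : ∀ {n} → (Fin n → Fin n → Bool) → ℕ
card {n} B = length (filter (λ p → Data.Nat._≤?_ 1 (if B (Data.Product.proj₁ p) (Data.Product.proj₂ p) then 1 else 0))
                     (filter (λ p → Data.Nat._<?_ (toℕ (Data.Product.proj₁ p)) (toℕ (Data.Product.proj₂ p)))
                       (concatMap (λ u → map (λ v → (u , v)) (allFin n)) (allFin n))))

delete : ∀ {n} → Graph n → (Fin n → Fin n → Bool) → Graph n
delete G B u v = G u v ∧ not (B u v)

Increases : ∀ {n} → Graph n → (Fin n → Fin n → Bool) → Set
Increases G B = ∀ k k' → IsγdR G k → IsγdR (delete G B) k' → k < k'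

IsbdR : ∀ {n} → Graph n → ℕ → Set
IsbdR G b = (∃[ B ] (IsEdgeSubset G B × card B ≡ b × Increases G B))
          × (∀ B → IsEdgeSubset G B → Increases G B → b ≤ card B)

-- the cycle C_n on vertices 0,…,n-1: i ~ j iff j ≡ i+1 or i ≡ j+1 (mod n)
-- (vertex set nonempty, so we may write the modulus as suc m)
succMod : ℕ → ℕ → ℕ
succMod m a = suc a % suc m

cycle : (n : ℕ) → Graph n
cycle zero ()
cycle (suc m) i j = ⌊ toℕ j ≟ succMod m (toℕ i) ⌋ ∨ ⌊ toℕ i ≟ succMod m (toℕ j) ⌋

-- A labelling of C_N is a DRDF exactly when every window (f(v-1), f(v), f(v+1)) is
-- admissible, a deleted edge acting like a neighbour labelled 1.  A potential on pairs of
-- consecutive labels shows that along a cycle every vertex pays at least 1, and more unless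
-- the labelling is 2,0,2,0,… or 0,0,3,0,0,3,…; so γdR(C_N) is N when 2 or 3 divides N and
-- N + 1 otherwise.  A second potential, depending on the position modulo 3, shows that a path
-- on l vertices costs at least l, plus 1 unless 3 divides l; the labelling 0,3,0,0,3,0,…
-- (preceded by a 2 when l ≡ 1 mod 3) attains this.  Deleting one edge of C_N leaves a path on
-- N vertices, which is more expensive than C_N exactly when N is even and not divisible by 3,
-- i.e. N ≡ 2, 4 (mod 6).  Otherwise two edges must go, cutting off a path on one or two
-- vertices.

module Submission where

open import Defs
open import Data.Nat
open import Data.Nat.Properties
open import Data.Nat.DivMod
open import Data.Nat.Divisibility using (_∣_; divides)
open import Data.Nat.GeneralisedArithmetic using (fold; fold-+)
open import Data.Nat.ListAction using (sum)
open import Data.Nat.Tactic.RingSolver using (solve-∀)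
open import Data.Fin using (Fin; toℕ; fromℕ<) renaming (zero to fzero; suc to fsuc)
open import Data.Fin.Properties using (toℕ-injective; toℕ-fromℕ<; toℕ<n)
open import Data.Bool using (Bool; true; false; _∧_; _∨_; not; if_then_else_; T)
open import Data.Bool.Properties using (T-∧; T-∨; T-≡; ∧-comm; ∨-comm; ∨-zeroʳ; ∧-zeroʳ; ∧-identityʳ)
open import Data.Unit using (tt)
open import Data.Empty using (⊥; ⊥-elim)
open import Data.Product using (Σ; ∃-syntax; _×_; _,_; proj₁; proj₂)
open import Data.Sum using (_⊎_; inj₁; inj₂; [_,_]′)
open import Data.List using (List; []; _∷_; _++_; map; filter; length; allFin; concatMap; tabulate)
open import Data.List.Properties using (map-tabulate)
open import Function using (_∘_; id; Equivalence)
open import Relation.Binary.PropositionalEquality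
open import Relation.Nullary using (¬_; Dec; yes; no)
open import Relation.Nullary.Decidable using (⌊_⌋; dec-true; isYes≗does)

sumTo : ℕ → (ℕ → ℕ) → ℕ
sumTo zero    g = 0
sumTo (suc n) g = g 0 + sumTo n (λ i → g (suc i))

sumTo-cong : ∀ n {g h : ℕ → ℕ} → (∀ i → i < n → g i ≡ h i) → sumTo n g ≡ sumTo n h
sumTo-cong zero    eq = refl
sumTo-cong (suc n) eq = cong₂ _+_ (eq 0 z<s) (sumTo-cong n (λ i i<n → eq (suc i) (s<s i<n)))

sumTo-+ : ∀ a b g → sumTo (a + b) g ≡ sumTo a g + sumTo b (λ j → g (a + j))
sumTo-+ zero    b g = refl
sumTo-+ (suc a) b g = trans (cong (g 0 +_) (sumTo-+ a b (λ i → g (suc i)))) (sym (+-assoc (g 0) _ _))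

sumTo-suc : ∀ n g → sumTo (suc n) g ≡ sumTo n g + g n
sumTo-suc n g = trans (cong (λ k → sumTo k g) (+-comm 1 n)) (trans (sumTo-+ n 1 g)
                  (cong (sumTo n g +_) (trans (+-identityʳ _) (cong g (+-identityʳ n)))))

sumTo-shift : ∀ n g → g n ≡ g 0 → sumTo n (λ i → g (suc i)) ≡ sumTo n g
sumTo-shift n g gn≡g0 = +-cancelʳ-≡ (g 0) _ _ (begin
    sumTo n (λ i → g (suc i)) + g 0  ≡⟨ +-comm _ (g 0) ⟩
    sumTo (suc n) g                  ≡⟨ sumTo-suc n g ⟩
    sumTo n g + g n                  ≡⟨ cong (sumTo n g +_) gn≡g0 ⟩
    sumTo n g + g 0                  ∎)
  where open ≡-Reasoning

sumTo-rotate : ∀ n g → (∀ i → g (i + n) ≡ g i) → ∀ c → sumTo n (λ i → g (i + c)) ≡ sumTo n g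
sumTo-rotate n g periodic zero = sumTo-cong n (λ i _ → cong g (+-identityʳ i))
sumTo-rotate n g periodic (suc c) = begin
    sumTo n (λ i → g (i + suc c))  ≡⟨ sumTo-cong n (λ i _ → cong g (+-suc i c)) ⟩
    sumTo n (λ i → g (suc i + c))  ≡⟨ sumTo-shift n (λ i → g (i + c)) (trans (cong g (+-comm n c)) (periodic c)) ⟩
    sumTo n (λ i → g (i + c))      ≡⟨ sumTo-rotate n g periodic c ⟩
    sumTo n g                      ∎
  where open ≡-Reasoning

sumTo-distrib : ∀ n g h → sumTo n (λ i → g i + h i) ≡ sumTo n g + sumTo n h
sumTo-distrib zero    g h = refl
sumTo-distrib (suc n) g h = trans (cong (g 0 + h 0 +_) (sumTo-distrib n _ _)) (interchange (g 0) (h 0) _ _)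
  where
  interchange : ∀ a b c d → a + b + (c + d) ≡ a + c + (b + d)
  interchange = solve-∀

sumTo-zero : ∀ n g → (∀ i → i < n → g i ≡ 0) → sumTo n g ≡ 0
sumTo-zero n g g≡0 = trans (sumTo-cong n g≡0) (zeros n)
  where
  zeros : ∀ n → sumTo n (λ _ → 0) ≡ 0
  zeros zero    = refl
  zeros (suc n) = zeros n

sumTo-single : ∀ n g a → a < n → (∀ i → i < n → i ≢ a → g i ≡ 0) → sumTo n g ≡ g a
sumTo-single (suc n) g zero    _         g≡0 =
  trans (cong (g 0 +_) (sumTo-zero n _ (λ i i<n → g≡0 (suc i) (s<s i<n) λ ()))) (+-identityʳ (g 0))
sumTo-single (suc n) g (suc a) (s<s a<n) g≡0 rewrite g≡0 0 z<s (λ ()) =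
  sumTo-single n (λ i → g (suc i)) a a<n (λ i i<n i≢a → g≡0 (suc i) (s<s i<n) (i≢a ∘ suc-injective))

term≤sumTo : ∀ n g i → i < n → g i ≤ sumTo n g
term≤sumTo (suc n) g zero    _         = m≤m+n (g 0) _
term≤sumTo (suc n) g (suc i) (s<s i<n) = ≤-trans (term≤sumTo n (λ j → g (suc j)) i i<n) (m≤n+m _ (g 0))

sumTo≡0⇒ : ∀ n g → sumTo n g ≡ 0 → ∀ i → i < n → g i ≡ 0
sumTo≡0⇒ n g sum≡0 i i<n = n≤0⇒n≡0 (subst (g i ≤_) sum≡0 (term≤sumTo n g i i<n))

sumTo≡1⇒ : ∀ n g → sumTo n g ≡ 1 →
           Σ ℕ λ a → a < n × g a ≡ 1 × (∀ i → i < n → i ≢ a → g i ≡ 0)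
sumTo≡1⇒ (suc n) g sum≡1 with g 0 in g0
... | zero =
  let (a , a<n , ga , rest) = sumTo≡1⇒ n (λ i → g (suc i)) sum≡1
  in suc a , s<s a<n , ga , λ { zero _ _ → g0 ; (suc i) (s<s i<n) i≢a → rest i i<n (λ i≡a → i≢a (cong suc i≡a)) }
... | suc zero =
  zero , z<s , g0 , λ { zero _ 0≢0 → ⊥-elim (0≢0 refl) ; (suc i) (s<s i<n) _ → sumTo≡0⇒ n _ (suc-injective sum≡1) i i<n }

sumTo-const : ∀ n c → sumTo n (λ _ → c) ≡ n * c
sumTo-const zero    c = refl
sumTo-const (suc n) c = cong (c +_) (sumTo-const n c)

sumTo-*ˡ : ∀ n k g → sumTo n (λ i → k * g i) ≡ k * sumTo n g
sumTo-*ˡ zero    k g = sym (*-zeroʳ k)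
sumTo-*ˡ (suc n) k g = trans (cong (k * g 0 +_) (sumTo-*ˡ n k (λ i → g (suc i)))) (sym (*-distribˡ-+ k (g 0) _))

telescope : ∀ n (cost gain pot : ℕ → ℕ) → (∀ i → i < n → cost i + pot (suc i) ≤ gain i + pot i) →
            sumTo n cost + pot n ≤ sumTo n gain + pot 0
telescope zero    cost gain pot step = ≤-refl
telescope (suc n) cost gain pot step = begin
    cost 0 + sumTo n (cost ∘ suc) + pot (suc n)   ≡⟨ +-assoc (cost 0) _ _ ⟩
    cost 0 + (sumTo n (cost ∘ suc) + pot (suc n)) ≤⟨ +-monoʳ-≤ (cost 0) shifted ⟩
    cost 0 + (sumTo n (gain ∘ suc) + pot 1)       ≡⟨ rearrange (cost 0) _ (pot 1) ⟩
    sumTo n (gain ∘ suc) + (cost 0 + pot 1)       ≤⟨ +-monoʳ-≤ (sumTo n (gain ∘ suc)) (step 0 z<s) ⟩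
    sumTo n (gain ∘ suc) + (gain 0 + pot 0)       ≡⟨ rearrange′ (sumTo n (gain ∘ suc)) (gain 0) (pot 0) ⟩
    gain 0 + sumTo n (gain ∘ suc) + pot 0         ∎
  where
  open ≤-Reasoning
  shifted = telescope n (cost ∘ suc) (gain ∘ suc) (pot ∘ suc) (λ i i<n → step (suc i) (s<s i<n))
  rearrange : ∀ a b c → a + (b + c) ≡ b + (a + c)
  rearrange = solve-∀
  rearrange′ : ∀ a b c → a + (b + c) ≡ b + a + c
  rearrange′ = solve-∀

[m+n]%o≡[m%o+n]%o : ∀ a b o .{{_ : NonZero o}} → (a + b) % o ≡ (a % o + b) % o
[m+n]%o≡[m%o+n]%o a b o = begin
    (a + b) % o                ≡⟨ %-distribˡ-+ a b o ⟩
    (a % o + b % o) % o        ≡⟨ cong (λ z → (z + b % o) % o) (sym (m%n%n≡m%n a o)) ⟩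
    (a % o % o + b % o) % o    ≡⟨ sym (%-distribˡ-+ (a % o) b o) ⟩
    (a % o + b) % o            ∎
  where open ≡-Reasoning

suc-% : ∀ i o .{{_ : NonZero o}} → suc i % o ≡ suc (i % o) % o
suc-% i o = trans (cong (_% o) (+-comm 1 i)) (trans ([m+n]%o≡[m%o+n]%o i 1 o) (cong (_% o) (+-comm (i % o) 1)))

by-residue-3 : (P : ℕ → Set) → (∀ q → P (q * 3)) → (∀ q → P (1 + q * 3)) → (∀ q → P (2 + q * 3)) → ∀ n → P n
by-residue-3 P p₀ p₁ p₂ n = subst P (sym (m≡m%n+[m/n]*n n 3)) (by-remainder (n % 3) (m%n<n n 3))
  where
  by-remainder : ∀ r → r < 3 → P (r + n / 3 * 3)
  by-remainder 0 _ = p₀ (n / 3)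
  by-remainder 1 _ = p₁ (n / 3)
  by-remainder 2 _ = p₂ (n / 3)
  by-remainder (suc (suc (suc _))) (s≤s (s≤s (s≤s ())))

∨-true : ∀ a b → a ∨ b ≡ true → a ≡ true ⊎ b ≡ true
∨-true true  b _  = inj₁ refl
∨-true false b eq = inj₂ eq

∨-introˡ : ∀ {a b} → a ≡ true → a ∨ b ≡ true
∨-introˡ refl = refl

∨-introʳ : ∀ {a b} → b ≡ true → a ∨ b ≡ true
∨-introʳ {a} refl = ∨-zeroʳ a

⌊⌋-true : ∀ {P : Set} (d : Dec P) → P → ⌊ d ⌋ ≡ true
⌊⌋-true d p = trans (isYes≗does d) (dec-true d p)

⌊⌋-witness : ∀ {P : Set} (d : Dec P) → ⌊ d ⌋ ≡ true → P
⌊⌋-witness (yes p) _ = p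

Between : ∀ {n} → ℕ → ℕ → Fin n → Fin n → Set
Between a b u v = (toℕ u ≡ a × toℕ v ≡ b) ⊎ (toℕ v ≡ a × toℕ u ≡ b)

module Positions (m : ℕ) where

  N : ℕ
  N = suc m

  [a+d]%N≢a : ∀ a d → a < N → 0 < d → d < N → (a + d) % N ≢ a
  [a+d]%N≢a a d a<N 0<d d<N eq with a + d <? N
  ... | yes a+d<N = <-irrefl refl (subst (a <_) (trans (sym (m<n⇒m%n≡m a+d<N)) eq) (m<m+n a 0<d))
  ... | no a+d≮N = <-irrefl refl (subst (_< N) (+-cancelˡ-≡ a d N (sym wraps)) d<N)
    where
    N≤a+d : N ≤ a + d
    N≤a+d = ≮⇒≥ a+d≮N
    reduced : a + d ∸ N ≡ a
    reduced = trans (sym (m<n⇒m%n≡m (+-cancelʳ-< N (a + d ∸ N) N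
                      (subst (_< N + N) (sym (m∸n+n≡m N≤a+d)) (+-mono-< a<N d<N)))))
                    (trans (m≤n⇒[n∸m]%m≡n%m N≤a+d) eq)
    wraps : a + N ≡ a + d
    wraps = trans (cong (_+ N) (sym reduced)) (m∸n+n≡m N≤a+d)

  vertex : ℕ → Fin N
  vertex i = fromℕ< (m%n<n i N)

  toℕ-vertex : ∀ i → toℕ (vertex i) ≡ i % N
  toℕ-vertex i = toℕ-fromℕ< (m%n<n i N)

  toℕ-vertex-< : ∀ i → i < N → toℕ (vertex i) ≡ i
  toℕ-vertex-< i i<N = trans (toℕ-vertex i) (m<n⇒m%n≡m i<N)

  vertex-toℕ : ∀ (x : Fin N) → vertex (toℕ x) ≡ x
  vertex-toℕ x = toℕ-injective (toℕ-vertex-< (toℕ x) (toℕ<n x))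

  vertex-+N : ∀ i → vertex (i + N) ≡ vertex i
  vertex-+N i = toℕ-injective (trans (toℕ-vertex (i + N))
                  (trans ([m+n]%n≡m%n i N) (sym (toℕ-vertex i))))

  pred-suc : ∀ i → suc (i + m) % N ≡ i % N
  pred-suc i = trans (cong (_% N) (sym (+-suc i m))) ([m+n]%n≡m%n i N)

  vertex-+≢ : ∀ j d → 0 < d → d < N → vertex (j + d) ≢ vertex j
  vertex-+≢ j d 0<d d<N eq = [a+d]%N≢a (j % N) d (m%n<n j N) 0<d d<N (begin
      (j % N + d) % N          ≡⟨ sym ([m+n]%o≡[m%o+n]%o j d N) ⟩
      (j + d) % N              ≡⟨ sym (toℕ-vertex (j + d)) ⟩
      toℕ (vertex (j + d))     ≡⟨ cong toℕ eq ⟩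
      toℕ (vertex j)           ≡⟨ toℕ-vertex j ⟩
      j % N                    ∎)
    where open ≡-Reasoning

module Cycle (m : ℕ) (2≤m : 2 ≤ m) where
  open Positions m public

  C : Graph N
  C = cycle N

  1≤m : 1 ≤ m
  1≤m = ≤-trans (s≤s z≤n) 2≤m

  C-sym : ∀ u v → C u v ≡ C v u
  C-sym u v = ∨-comm ⌊ toℕ v ≟ suc (toℕ u) % N ⌋ ⌊ toℕ u ≟ suc (toℕ v) % N ⌋

  adj-suc : ∀ i → Adj C (vertex i) (vertex (suc i))
  adj-suc i = ∨-introˡ (⌊⌋-true (toℕ (vertex (suc i)) ≟ suc (toℕ (vertex i)) % N)
                (trans (toℕ-vertex (suc i)) (trans (suc-% i N) (cong (λ z → suc z % N) (sym (toℕ-vertex i))))))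

  adj-pred : ∀ i → Adj C (vertex i) (vertex (i + m))
  adj-pred i = trans (C-sym (vertex i) (vertex (i + m))) (subst (λ v → Adj C (vertex (i + m)) v) (vertex-+N i)
                 (subst (λ w → Adj C (vertex (i + m)) (vertex w)) (sym (+-suc i m)) (adj-suc (i + m))))

  neighbours : ∀ i w → Adj C (vertex i) w → w ≡ vertex (suc i) ⊎ w ≡ vertex (i + m)
  neighbours i w adj with ∨-true ⌊ toℕ w ≟ suc (toℕ (vertex i)) % N ⌋ _ adj
  ... | inj₁ w-suc = inj₁ (toℕ-injective (begin
      toℕ w                        ≡⟨ ⌊⌋-witness (toℕ w ≟ _) w-suc ⟩
      suc (toℕ (vertex i)) % N     ≡⟨ cong (λ z → suc z % N) (toℕ-vertex i) ⟩
      suc (i % N) % N              ≡⟨ sym (suc-% i N) ⟩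
      suc i % N                    ≡⟨ sym (toℕ-vertex (suc i)) ⟩
      toℕ (vertex (suc i))         ∎))
    where open ≡-Reasoning
  ... | inj₂ i-suc = inj₂ (toℕ-injective (sym (begin
      toℕ (vertex (i + m))             ≡⟨ toℕ-vertex (i + m) ⟩
      (i + m) % N                      ≡⟨ [m+n]%o≡[m%o+n]%o i m N ⟩
      (i % N + m) % N                  ≡⟨ cong (λ z → (z + m) % N) (trans (sym (toℕ-vertex i)) i≡) ⟩
      (suc (toℕ w) % N + m) % N        ≡⟨ sym ([m+n]%o≡[m%o+n]%o (suc (toℕ w)) m N) ⟩
      (suc (toℕ w) + m) % N            ≡⟨ suc-w+m ⟩
      toℕ w                            ∎)))
    where
    open ≡-Reasoning
    i≡ : toℕ (vertex i) ≡ suc (toℕ w) % N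
    i≡ = ⌊⌋-witness (toℕ (vertex i) ≟ _) i-suc
    suc-w+m : (suc (toℕ w) + m) % N ≡ toℕ w
    suc-w+m = trans (cong (_% N) (+-comm (suc (toℕ w)) m))
                  (trans (cong (_% N) (+-suc m (toℕ w))) (trans (cong (λ z → suc z % N) (+-comm m (toℕ w)))
                  (trans (pred-suc (toℕ w)) (m<n⇒m%n≡m (toℕ<n w)))))

  suc≢pred : ∀ i → vertex (suc i) ≢ vertex (i + m)
  suc≢pred i eq = vertex-+≢ (suc i) (m ∸ 1) (∸-monoˡ-≤ 1 2≤m) (s≤s (m∸n≤m m 1))
                    (trans (cong vertex i+m≡) (sym eq))
    where
    i+m≡ : suc i + (m ∸ 1) ≡ i + m
    i+m≡ = trans (sym (+-suc i (m ∸ 1))) (cong (i +_) (m+[n∸m]≡n 1≤m))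

  C-irreflexive : ∀ u → ¬ Adj C u u
  C-irreflexive u adj with neighbours (toℕ u) u (subst (λ x → Adj C x u) (sym (vertex-toℕ u)) adj)
  ... | inj₁ u≡suc = vertex-+≢ (toℕ u) 1 z<s (s≤s 1≤m)
                       (trans (cong vertex (+-comm (toℕ u) 1)) (trans (sym u≡suc) (sym (vertex-toℕ u))))
  ... | inj₂ u≡pred = vertex-+≢ (toℕ u) m 1≤m (n<1+n m)
                        (trans (sym u≡pred) (sym (vertex-toℕ u)))

-- DRDFs of subgraphs of C_N as labellings with admissible windows

_⊆_ : ∀ {n} → Graph n → Graph n → Set
G ⊆ H = ∀ u v → Adj G u v → Adj H u v

IsDRDF-mono : ∀ {n} {G H : Graph n} {f} → G ⊆ H → IsDRDF G f → IsDRDF H f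
IsDRDF-mono G⊆H (bounded , zero-ok , one-ok) = bounded , zero-ok′ , one-ok′
  where
  zero-ok′ = λ v fv≡0 → Data.Sum.map
    (λ (w , adj , fw≡3) → w , G⊆H _ _ adj , fw≡3)
    (λ (u , u′ , u≢u′ , adj , adj′ , fu≡2 , fu′≡2) →
       u , u′ , u≢u′ , G⊆H _ _ adj , G⊆H _ _ adj′ , fu≡2 , fu′≡2)
    (zero-ok v fv≡0)
  one-ok′ = λ v fv≡1 → let (w , adj , 2≤fw) = one-ok v fv≡1 in w , G⊆H _ _ adj , 2≤fw

delete-⊆ : ∀ {n} (G B : Graph n) → delete G B ⊆ G
delete-⊆ G B u v adj with G u v
... | true  = refl
... | false = adj

-- admissible a b c: a vertex labelled b whose two neighbours are labelled a and c satisfies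
-- the DRDF conditions.  A missing neighbour is given the label 1, which never helps.
admissible : ℕ → ℕ → ℕ → Bool
admissible a zero          c = (a ≡ᵇ 3) ∨ (c ≡ᵇ 3) ∨ ((a ≡ᵇ 2) ∧ (c ≡ᵇ 2))
admissible a (suc zero)    c = (2 ≤ᵇ a) ∨ (2 ≤ᵇ c)
admissible a (suc (suc b)) c = b ≤ᵇ 1

admissible-0 : ∀ a c → T (admissible a 0 c) → a ≡ 3 ⊎ c ≡ 3 ⊎ (a ≡ 2 × c ≡ 2)
admissible-0 a c ok with Equivalence.to T-∨ ok
... | inj₁ a≡3 = inj₁ (≡ᵇ⇒≡ a 3 a≡3)
... | inj₂ ok′ with Equivalence.to T-∨ ok′
...   | inj₁ c≡3 = inj₂ (inj₁ (≡ᵇ⇒≡ c 3 c≡3))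
...   | inj₂ both = let (a≡2 , c≡2) = Equivalence.to T-∧ both
                    in inj₂ (inj₂ (≡ᵇ⇒≡ a 2 a≡2 , ≡ᵇ⇒≡ c 2 c≡2))

admissible-1 : ∀ a c → T (admissible a 1 c) → 2 ≤ a ⊎ 2 ≤ c
admissible-1 a c ok = Data.Sum.map (≤ᵇ⇒≤ 2 a) (≤ᵇ⇒≤ 2 c) (Equivalence.to T-∨ ok)

admissible⇒≤3 : ∀ a b c → T (admissible a b c) → b ≤ 3
admissible⇒≤3 a zero          c _  = z≤n
admissible⇒≤3 a (suc zero)    c _  = s≤s z≤n
admissible⇒≤3 a (suc (suc b)) c ok = s≤s (s≤s (≤ᵇ⇒≤ b 1 ok))

admissible-0-intro : ∀ {a c} → a ≡ 3 ⊎ c ≡ 3 ⊎ (a ≡ 2 × c ≡ 2) → T (admissible a 0 c)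
admissible-0-intro         (inj₁ refl)                 = tt
admissible-0-intro {a} {c} (inj₂ (inj₁ refl))          = Equivalence.from (T-∨ {a ≡ᵇ 3}) (inj₂ tt)
admissible-0-intro         (inj₂ (inj₂ (refl , refl))) = tt

admissible-1-intro : ∀ {a c} → 2 ≤ a ⊎ 2 ≤ c → T (admissible a 1 c)
admissible-1-intro = Equivalence.from T-∨ ∘ Data.Sum.map ≤⇒≤ᵇ ≤⇒≤ᵇ

admissible-≥2 : ∀ a b c → 2 ≤ b → b ≤ 3 → T (admissible a b c)
admissible-≥2 a (suc (suc b)) c _        (s≤s (s≤s b≤1)) = ≤⇒≤ᵇ b≤1
admissible-≥2 a (suc zero)    c (s≤s ()) _

admissible-weaken : ∀ {a a′ b c c′} → a ≡ a′ ⊎ a ≡ 1 → c ≡ c′ ⊎ c ≡ 1 →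
                    T (admissible a b c) → T (admissible a′ b c′)
admissible-weaken {a} {b = zero} {c} a~ c~ ok =
  admissible-0-intro (Data.Sum.map (keep a~) (Data.Sum.map (keep c~) (λ (a≡2 , c≡2) → keep a~ a≡2 , keep c~ c≡2))
    (admissible-0 a c ok))
  where
  keep : ∀ {x y k} → x ≡ y ⊎ x ≡ 1 → x ≡ suc (suc k) → y ≡ suc (suc k)
  keep (inj₁ refl) x≡ = x≡
  keep (inj₂ refl) ()
admissible-weaken {a} {b = suc zero} {c} a~ c~ ok =
  admissible-1-intro (Data.Sum.map (keep a~) (keep c~) (admissible-1 a c ok))
  where
  keep : ∀ {x y} → x ≡ y ⊎ x ≡ 1 → 2 ≤ x → 2 ≤ y
  keep (inj₁ refl) 2≤x      = 2≤x
  keep (inj₂ refl) (s≤s ())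
admissible-weaken {b = suc (suc b)} _ _ ok = ok

1≱2 : ¬ 2 ≤ 1
1≱2 (s≤s ())

≡2+⇒2≤ : ∀ {x k} → x ≡ suc (suc k) → 2 ≤ x
≡2+⇒2≤ refl = s≤s (s≤s z≤n)

if-true : ∀ {b} {A : Set} (x y : A) → b ≡ true → (if b then x else y) ≡ x
if-true x y refl = refl

if-false : ∀ {b} {A : Set} (x y : A) → b ≡ false → (if b then x else y) ≡ y
if-false x y refl = refl

module SubgraphOfCycle (m : ℕ) (2≤m : 2 ≤ m) (G : Graph (suc m)) (G⊆C : G ⊆ cycle (suc m)) where
  open Cycle m 2≤m

  module _ (f : Fin N → ℕ) where

    label-pred : ℕ → ℕ
    label-pred i = if G (vertex i) (vertex (i + m)) then f (vertex (i + m)) else 1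

    label-succ : ℕ → ℕ
    label-succ i = if G (vertex i) (vertex (suc i)) then f (vertex (suc i)) else 1

    label-pred-cases : ∀ i → label-pred i ≡ f (vertex (i + m)) ⊎ label-pred i ≡ 1
    label-pred-cases i with G (vertex i) (vertex (i + m))
    ... | true  = inj₁ refl
    ... | false = inj₂ refl

    label-succ-cases : ∀ i → label-succ i ≡ f (vertex (suc i)) ⊎ label-succ i ≡ 1
    label-succ-cases i with G (vertex i) (vertex (suc i))
    ... | true  = inj₁ refl
    ... | false = inj₂ refl

    private
      neighbour-label : ∀ i w → Adj G (vertex i) w → label-succ i ≡ f w ⊎ label-pred i ≡ f w
      neighbour-label i w adj with neighbours i w (G⊆C _ _ adj)
      ... | inj₁ refl = inj₁ (if-true _ 1 adj)
      ... | inj₂ refl = inj₂ (if-true _ 1 adj)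

      two-neighbours-2 : ∀ i u u′ → u ≢ u′ → Adj G (vertex i) u → Adj G (vertex i) u′ → f u ≡ 2 → f u′ ≡ 2 →
                         label-pred i ≡ 2 × label-succ i ≡ 2
      two-neighbours-2 i u u′ u≢u′ adj adj′ fu fu′
        with neighbours i u (G⊆C _ _ adj) | neighbours i u′ (G⊆C _ _ adj′)
      ... | inj₁ refl | inj₁ refl = ⊥-elim (u≢u′ refl)
      ... | inj₂ refl | inj₂ refl = ⊥-elim (u≢u′ refl)
      ... | inj₁ refl | inj₂ refl = trans (if-true _ 1 adj′) fu′ , trans (if-true _ 1 adj) fu
      ... | inj₂ refl | inj₁ refl = trans (if-true _ 1 adj) fu , trans (if-true _ 1 adj′) fu′

      label-pred-≥2 : ∀ i → 2 ≤ label-pred i → Adj G (vertex i) (vertex (i + m)) × f (vertex (i + m)) ≡ label-pred i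
      label-pred-≥2 i 2≤ with G (vertex i) (vertex (i + m))
      ... | true  = refl , refl
      ... | false = ⊥-elim (1≱2 2≤)

      label-succ-≥2 : ∀ i → 2 ≤ label-succ i → Adj G (vertex i) (vertex (suc i)) × f (vertex (suc i)) ≡ label-succ i
      label-succ-≥2 i 2≤ with G (vertex i) (vertex (suc i))
      ... | true  = refl , refl
      ... | false = ⊥-elim (1≱2 2≤)

      at-vertex : {P : Fin N → Set} → (∀ i → P (vertex i)) → ∀ v → P v
      at-vertex {P} p v = subst P (vertex-toℕ v) (p (toℕ v))

    admissible-at : ℕ → Set
    admissible-at i = T (admissible (label-pred i) (f (vertex i)) (label-succ i))

    IsDRDF⇒admissible : IsDRDF G f → ∀ i → admissible-at i
    IsDRDF⇒admissible (bounded , zero-ok , one-ok) i with f (vertex i) in fi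
    ... | zero with zero-ok (vertex i) fi
    ...   | inj₁ (w , adj , fw≡3) = admissible-0-intro
      (Data.Sum.map (λ pred≡ → trans pred≡ fw≡3) (λ succ≡ → inj₁ (trans succ≡ fw≡3)) (Data.Sum.swap (neighbour-label i w adj)))
    ...   | inj₂ (u , u′ , u≢u′ , adj , adj′ , fu , fu′) =
      admissible-0-intro (inj₂ (inj₂ (two-neighbours-2 i u u′ u≢u′ adj adj′ fu fu′)))
    IsDRDF⇒admissible (bounded , zero-ok , one-ok) i | suc zero with one-ok (vertex i) fi
    ...   | w , adj , 2≤fw = admissible-1-intro
      (Data.Sum.map (λ pred≡ → subst (2 ≤_) (sym pred≡) 2≤fw) (λ succ≡ → subst (2 ≤_) (sym succ≡) 2≤fw)
        (Data.Sum.swap (neighbour-label i w adj)))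
    IsDRDF⇒admissible (bounded , zero-ok , one-ok) i | suc (suc b) =
      admissible-≥2 (label-pred i) (suc (suc b)) (label-succ i) (s≤s (s≤s z≤n)) (subst (_≤ 3) fi (bounded (vertex i)))

    admissible⇒IsDRDF : (∀ i → admissible-at i) → IsDRDF G f
    admissible⇒IsDRDF ok = at-vertex (λ i → admissible⇒≤3 _ _ _ (ok i)) , at-vertex zero-ok , at-vertex one-ok
      where
      ok′ : ∀ {i b} → f (vertex i) ≡ b → T (admissible (label-pred i) b (label-succ i))
      ok′ {i} fi = subst (λ b → T (admissible (label-pred i) b (label-succ i))) fi (ok i)

      zero-ok : ∀ i → f (vertex i) ≡ 0 →
          (∃[ w ] (Adj G (vertex i) w × f w ≡ 3))
        ⊎ (∃[ u ] ∃[ u′ ] (u ≢ u′ × Adj G (vertex i) u × Adj G (vertex i) u′ × f u ≡ 2 × f u′ ≡ 2))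
      zero-ok i fi with admissible-0 (label-pred i) (label-succ i) (ok′ fi)
      ... | inj₁ a≡3 = let (adj , f≡) = label-pred-≥2 i (≡2+⇒2≤ a≡3) in inj₁ (_ , adj , trans f≡ a≡3)
      ... | inj₂ (inj₁ c≡3) = let (adj , f≡) = label-succ-≥2 i (≡2+⇒2≤ c≡3) in inj₁ (_ , adj , trans f≡ c≡3)
      ... | inj₂ (inj₂ (a≡2 , c≡2)) =
        let (adj , fa≡) = label-pred-≥2 i (≡2+⇒2≤ a≡2) ; (adj′ , fc≡) = label-succ-≥2 i (≡2+⇒2≤ c≡2)
        in inj₂ (_ , _ , suc≢pred i , adj′ , adj , trans fc≡ c≡2 , trans fa≡ a≡2)

      one-ok : ∀ i → f (vertex i) ≡ 1 → ∃[ w ] (Adj G (vertex i) w × 2 ≤ f w)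
      one-ok i fi with admissible-1 (label-pred i) (label-succ i) (ok′ fi)
      ... | inj₁ 2≤a = let (adj , f≡) = label-pred-≥2 i 2≤a in _ , adj , subst (2 ≤_) (sym f≡) 2≤a
      ... | inj₂ 2≤c = let (adj , f≡) = label-succ-≥2 i 2≤c in _ , adj , subst (2 ≤_) (sym f≡) 2≤c

allBelow : ℕ → (ℕ → Bool) → Bool
allBelow zero    P = true
allBelow (suc n) P = P 0 ∧ allBelow n (P ∘ suc)

allBelow-sound : ∀ n P → T (allBelow n P) → ∀ {a} → a < n → T (P a)
allBelow-sound (suc n) P all {zero}  _         = proj₁ (Equivalence.to T-∧ all)
allBelow-sound (suc n) P all {suc a} (s<s a<n) = allBelow-sound n (P ∘ suc) (proj₂ (Equivalence.to T-∧ all)) a<n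

-- The windows without slack are (2,0,2), (0,2,0), (0,0,3), (0,3,0) and (3,0,0); chaining
-- them forces the periodic labellings 2,0,2,0,… and 0,0,3,0,0,3,….
tight : ℕ → ℕ → Bool
tight 2 0 = true
tight 0 2 = true
tight 0 3 = true
tight 3 0 = true
tight 0 0 = true
tight _ _ = false

tightNext : ℕ → ℕ → ℕ
tightNext 2 0 = 2
tightNext 0 0 = 3
tightNext _ _ = 0

slack : ℕ → ℕ → ℕ → ℕ
slack a b c = if tight a b ∧ (c ≡ᵇ tightNext a b) then 0 else 1

-- Potentials on pairs of consecutive labels, found by computer.  They exist because along
-- every closed walk of admissible windows the average label is at least 1, with a surplus of
-- 1/6 for each window with slack.
cyclePotential : ℕ → ℕ → ℕ
cyclePotential 0 0 = 6
cyclePotential 0 1 = 5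
cyclePotential 0 2 = 3
cyclePotential 0 _ = 0
cyclePotential 1 0 = 7
cyclePotential 1 1 = 7
cyclePotential 1 _ = 4
cyclePotential 2 0 = 9
cyclePotential 2 _ = 8
cyclePotential 3 0 = 12
cyclePotential _ _ = 11

-- The third argument is the position modulo 3.
pathPotential : ℕ → ℕ → ℕ → ℕ
pathPotential 0 0 0 = 1
pathPotential 0 1 0 = 1
pathPotential 0 0 _ = 2
pathPotential 0 1 _ = 2
pathPotential 0 3 1 = 0
pathPotential 0 _ _ = 1
pathPotential 1 _ 0 = 1
pathPotential 1 0 1 = 2
pathPotential 1 1 1 = 2
pathPotential 1 _ 1 = 1
pathPotential 1 _ _ = 2
pathPotential 2 _ _ = 2
pathPotential _ _ 2 = 2
pathPotential _ _ _ = 3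

allWindows : (ℕ → ℕ → ℕ → Bool) → Bool
allWindows P = allBelow 4 λ a → allBelow 4 λ b → allBelow 4 (P a b)

admissible⇒ : ∀ (P : ℕ → ℕ → ℕ → Bool) → T (allWindows λ a b c → not (admissible a b c) ∨ P a b c) →
              ∀ {a b c} → a ≤ 3 → b ≤ 3 → c ≤ 3 → T (admissible a b c) → T (P a b c)
admissible⇒ P table {a} {b} {c} a≤3 b≤3 c≤3 ok = implies (admissible a b c) at-abc ok
  where
  check : ℕ → ℕ → ℕ → Bool
  check a b c = not (admissible a b c) ∨ P a b c
  at-abc : T (check a b c)
  at-abc = allBelow-sound 4 (check a b)
    (allBelow-sound 4 (λ b → allBelow 4 (check a b))
      (allBelow-sound 4 (λ a → allBelow 4 λ b → allBelow 4 (check a b)) table (s≤s a≤3)) (s≤s b≤3)) (s≤s c≤3)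
  implies : ∀ x {y} → T (not x ∨ y) → T x → T y
  implies true y _ = y

cycle-step : ∀ {a b c} → a ≤ 3 → b ≤ 3 → c ≤ 3 → T (admissible a b c) →
             6 + slack a b c + cyclePotential b c ≤ 6 * b + cyclePotential a b
cycle-step a≤3 b≤3 c≤3 ok = ≤ᵇ⇒≤ _ _
  (admissible⇒ (λ a b c → 6 + slack a b c + cyclePotential b c ≤ᵇ 6 * b + cyclePotential a b) tt a≤3 b≤3 c≤3 ok)

path-step : ∀ {a b c r} → a ≤ 3 → b ≤ 3 → c ≤ 3 → r < 3 → T (admissible a b c) →
            1 + pathPotential b c (suc r % 3) ≤ b + pathPotential a b r
path-step {a} {b} {c} a≤3 b≤3 c≤3 r<3 ok = ≤ᵇ⇒≤ _ _ (allBelow-sound 3 (check a b c)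
  (admissible⇒ (λ a b c → allBelow 3 (check a b c)) tt a≤3 b≤3 c≤3 ok) r<3)
  where
  check : ℕ → ℕ → ℕ → ℕ → Bool
  check a b c r = 1 + pathPotential b c (suc r % 3) ≤ᵇ b + pathPotential a b r

path-end : ∀ {y r} → y ≤ 3 → r < 3 → 1 + (if r ≡ᵇ 0 then 0 else 1) ≤ pathPotential y 1 r
path-end {y} {r} y≤3 r<3 = ≤ᵇ⇒≤ _ _ (allBelow-sound 3 (check y)
  (allBelow-sound 4 (λ y → allBelow 3 (check y)) tt (s≤s y≤3)) r<3)
  where
  check : ℕ → ℕ → Bool
  check y r = 1 + (if r ≡ᵇ 0 then 0 else 1) ≤ᵇ pathPotential y 1 r

-- Lower bounds

fold-*-fixed : ∀ {A : Set} (f : A → A) z p → fold z f p ≡ z → ∀ k → fold z f (k * p) ≡ z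
fold-*-fixed f z p fixed zero    = refl
fold-*-fixed f z p fixed (suc k) =
  trans (fold-+ z f p) (trans (cong (λ y → fold y f p) (fold-*-fixed f z p fixed k)) fixed)

fold-% : ∀ {A : Set} (f : A → A) z p .{{_ : NonZero p}} → fold z f p ≡ z → ∀ n → fold z f n ≡ fold z f (n % p)
fold-% f z p fixed n = begin
    fold z f n                             ≡⟨ cong (fold z f) (m≡m%n+[m/n]*n n p) ⟩
    fold z f (n % p + n / p * p)           ≡⟨ fold-+ z f (n % p) ⟩
    fold (fold z f (n / p * p)) f (n % p)  ≡⟨ cong (λ y → fold y f (n % p)) (fold-*-fixed f z p fixed (n / p)) ⟩
    fold z f (n % p)                       ∎
  where open ≡-Reasoning

period-divides : ∀ {A : Set} (f : A → A) z p .{{_ : NonZero p}} → fold z f p ≡ z →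
                 (∀ r → 0 < r → r < p → fold z f r ≢ z) → ∀ n → fold z f n ≡ z → n % p ≡ 0
period-divides f z p fixed earlier n returns with n % p | m%n<n n p | fold-% f z p fixed n
... | zero  | _   | _  = refl
... | suc r | r<p | eq = ⊥-elim (earlier (suc r) z<s r<p (trans (sym eq) returns))

tightStep : ℕ × ℕ → ℕ × ℕ
tightStep (a , b) = b , tightNext a b

slack≡0⇒ : ∀ a b c → slack a b c ≡ 0 → T (tight a b) × c ≡ tightNext a b
slack≡0⇒ a b c slack≡0 with tight a b ∧ (c ≡ᵇ tightNext a b) in eq
... | true = let (t , c≡) = Equivalence.to T-∧ (subst T (sym eq) _) in t , ≡ᵇ⇒≡ c _ c≡

no-return-before-2 : ∀ {A : Set} (f : A → A) z → f z ≢ z → ∀ r → 0 < r → r < 2 → fold z f r ≢ z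
no-return-before-2 f z fz≢z 1             _ _ = fz≢z
no-return-before-2 f z fz≢z (suc (suc _)) _ (s≤s (s≤s ()))

no-return-before-3 : ∀ {A : Set} (f : A → A) z → f z ≢ z → f (f z) ≢ z → ∀ r → 0 < r → r < 3 → fold z f r ≢ z
no-return-before-3 f z fz≢z ffz≢z 1                   _ _ = fz≢z
no-return-before-3 f z fz≢z ffz≢z 2                   _ _ = ffz≢z
no-return-before-3 f z fz≢z ffz≢z (suc (suc (suc _))) _ (s≤s (s≤s (s≤s ())))

tight-period : ∀ a b → T (tight a b) → ∀ n → fold (a , b) tightStep n ≡ (a , b) → n % 2 ≡ 0 ⊎ n % 3 ≡ 0
tight-period 2 0 _ n returns = inj₁ (period-divides tightStep _ 2 refl (no-return-before-2 tightStep _ λ ()) n returns)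
tight-period 0 2 _ n returns = inj₁ (period-divides tightStep _ 2 refl (no-return-before-2 tightStep _ λ ()) n returns)
tight-period 0 3 _ n returns = inj₂ (period-divides tightStep _ 3 refl (no-return-before-3 tightStep _ (λ ()) λ ()) n returns)
tight-period 3 0 _ n returns = inj₂ (period-divides tightStep _ 3 refl (no-return-before-3 tightStep _ (λ ()) λ ()) n returns)
tight-period 0 0 _ n returns = inj₂ (period-divides tightStep _ 3 refl (no-return-before-3 tightStep _ (λ ()) λ ()) n returns)

module LabelledCycle (q : ℕ → ℕ) (q≤3 : ∀ i → q i ≤ 3)
                     (q-ok : ∀ i → T (admissible (q i) (q (suc i)) (q (suc (suc i))))) where

  windowSlack : ℕ → ℕ
  windowSlack i = slack (q i) (q (suc i)) (q (suc (suc i)))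

  potential : ℕ → ℕ
  potential i = cyclePotential (q i) (q (suc i))

  potential-bound : ∀ n → n * 6 + sumTo n windowSlack + potential n ≤ 6 * sumTo n (q ∘ suc) + potential 0
  potential-bound n = subst₂ (λ x y → x + potential n ≤ y + potential 0)
    (trans (sumTo-distrib n (λ _ → 6) windowSlack) (cong (_+ sumTo n windowSlack) (sumTo-const n 6)))
    (sumTo-*ˡ n 6 (q ∘ suc))
    (telescope n (λ i → 6 + windowSlack i) (λ i → 6 * q (suc i)) potential
      (λ i _ → cycle-step (q≤3 i) (q≤3 (suc i)) (q≤3 (suc (suc i))) (q-ok i)))

  tight-orbit : ∀ n → (∀ i → i < n → windowSlack i ≡ 0) →
                ∀ i → i ≤ n → (q i , q (suc i)) ≡ fold (q 0 , q 1) tightStep i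
  tight-orbit n tight zero    _     = refl
  tight-orbit n tight (suc i) i<n =
    trans (cong (q (suc i) ,_) (proj₂ (slack≡0⇒ (q i) (q (suc i)) (q (suc (suc i))) (tight i i<n))))
          (cong tightStep (tight-orbit n tight i (<⇒≤ i<n)))

  module Periodic (n : ℕ) (q-period₀ : q n ≡ q 0) (q-period₁ : q (suc n) ≡ q 1) where

    weight-bound : n * 6 + sumTo n windowSlack ≤ 6 * sumTo n (q ∘ suc)
    weight-bound = +-cancelʳ-≤ (potential 0) _ _
      (subst (λ p → n * 6 + sumTo n windowSlack + p ≤ 6 * sumTo n (q ∘ suc) + potential 0)
        (cong₂ cyclePotential q-period₀ q-period₁) (potential-bound n))

    n≤weight : n ≤ sumTo n (q ∘ suc)
    n≤weight = *-cancelˡ-≤ 6 (≤-trans (≤-reflexive (*-comm 6 n)) (≤-trans (m≤m+n (n * 6) _) weight-bound))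

    n<weight : ¬ (n % 2 ≡ 0) → ¬ (n % 3 ≡ 0) → n < sumTo n (q ∘ suc)
    n<weight n%2≢0 n%3≢0 with sumTo n windowSlack in slack-sum
    ... | suc s = *-cancelˡ-< 6 _ _ (≤-trans (≤-reflexive (cong suc (*-comm 6 n))) (≤-trans
                    (subst (suc (n * 6) ≤_) (sym (+-suc (n * 6) s)) (s≤s (m≤m+n (n * 6) s)))
                    (subst (λ x → n * 6 + x ≤ 6 * sumTo n (q ∘ suc)) slack-sum weight-bound)))
    ... | zero = ⊥-elim ([ n%2≢0 , n%3≢0 ]′ (tight-period (q 0) (q 1) tight₀ n returns))
      where
      all-tight : ∀ i → i < n → windowSlack i ≡ 0
      all-tight = sumTo≡0⇒ n windowSlack slack-sum
      0<n : 0 < n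
      0<n = n≢0⇒n>0 (λ n≡0 → n%2≢0 (subst (λ x → x % 2 ≡ 0) (sym n≡0) refl))
      tight₀ : T (tight (q 0) (q 1))
      tight₀ = proj₁ (slack≡0⇒ (q 0) (q 1) (q 2) (all-tight 0 0<n))
      returns : fold (q 0 , q 1) tightStep n ≡ (q 0 , q 1)
      returns = trans (sym (tight-orbit n all-tight n ≤-refl)) (cong₂ _,_ q-period₀ q-period₁)

γdR-path : ℕ → ℕ
γdR-path l = l + (if l % 3 ≡ᵇ 0 then 0 else 1)

γdR-path-0 : ∀ l → l % 3 ≡ 0 → γdR-path l ≡ l
γdR-path-0 l l%3≡0 rewrite l%3≡0 = +-identityʳ l

γdR-path-≢0 : ∀ l → ¬ (l % 3 ≡ 0) → γdR-path l ≡ suc l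
γdR-path-≢0 l l%3≢0 with l % 3
... | zero  = ⊥-elim (l%3≢0 refl)
... | suc _ = +-comm l 1

-- A path on l vertices labelled p 0 … p (l ∸ 1), padded with the dummy label 1 at both ends.
withEnds : ℕ → (ℕ → ℕ) → ℕ → ℕ
withEnds l p zero    = 1
withEnds l p (suc j) = if j <ᵇ l then p j else 1

n<ᵇn : ∀ n → (n <ᵇ n) ≡ false
n<ᵇn zero    = refl
n<ᵇn (suc n) = n<ᵇn n

withEnds-in : ∀ l p {j} → j < l → withEnds l p (suc j) ≡ p j
withEnds-in l p j<l rewrite Equivalence.to T-≡ (<⇒<ᵇ j<l) = refl

withEnds-out : ∀ l p → withEnds l p (suc l) ≡ 1
withEnds-out l p rewrite n<ᵇn l = refl

PathWindows : ℕ → (ℕ → ℕ) → Set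
PathWindows l p = ∀ j → j < l → T (admissible (withEnds l p j) (withEnds l p (suc j)) (withEnds l p (suc (suc j))))

γdR-path≤sumTo : ∀ l p → (∀ j → j < l → p j ≤ 3) → PathWindows l p → γdR-path l ≤ sumTo l p
γdR-path≤sumTo l p p≤3 ok = +-cancelʳ-≤ 1 _ _ (begin
    l + e + 1                          ≡⟨ +-assoc l e 1 ⟩
    l + (e + 1)                        ≡⟨ cong (l +_) (+-comm e 1) ⟩
    l + (1 + e)                        ≤⟨ +-monoʳ-≤ l (subst (λ y → 1 + e ≤ pathPotential (q l) y (l % 3))
                                            (sym (withEnds-out l p)) (path-end (q≤3 l) (m%n<n l 3))) ⟩
    l + potential l                    ≡⟨ cong (_+ potential l) (trans (sym (*-identityʳ l)) (sym (sumTo-const l 1))) ⟩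
    sumTo l (λ _ → 1) + potential l    ≤⟨ telescope l (λ _ → 1) (q ∘ suc) potential step ⟩
    sumTo l (q ∘ suc) + 1              ≡⟨ cong (_+ 1) (sumTo-cong l (λ j → withEnds-in l p)) ⟩
    sumTo l p + 1                      ∎)
  where
  open ≤-Reasoning
  e = if l % 3 ≡ᵇ 0 then 0 else 1
  q = withEnds l p
  q≤3 : ∀ i → q i ≤ 3
  q≤3 zero    = s≤s z≤n
  q≤3 (suc j) with j <ᵇ l in j<ᵇl
  ... | true  = p≤3 j (<ᵇ⇒< j l (subst T (sym j<ᵇl) _))
  ... | false = s≤s z≤n
  potential : ℕ → ℕ
  potential i = pathPotential (q i) (q (suc i)) (i % 3)
  step : ∀ i → i < l → 1 + potential (suc i) ≤ q (suc i) + potential i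
  step i i<l = subst (λ r → 1 + pathPotential (q (suc i)) (q (suc (suc i))) r ≤ q (suc i) + potential i)
                 (sym (suc-% i 3))
                 (path-step (q≤3 i) (q≤3 (suc i)) (q≤3 (suc (suc i))) (m%n<n i 3) (ok i i<l))

weight≡sumTo : ∀ n (f : Fin n → ℕ) (g : ℕ → ℕ) → (∀ x → f x ≡ g (toℕ x)) → weight f ≡ sumTo n g
weight≡sumTo n f g f≡g = trans (cong sum (map-tabulate id f)) (sum-tabulate n f g f≡g)
  where
  sum-tabulate : ∀ n (f : Fin n → ℕ) (g : ℕ → ℕ) → (∀ x → f x ≡ g (toℕ x)) → sum (tabulate f) ≡ sumTo n g
  sum-tabulate zero    f g f≡g = refl
  sum-tabulate (suc n) f g f≡g = cong₂ _+_ (f≡g fzero) (sum-tabulate n (f ∘ fsuc) (g ∘ suc) (f≡g ∘ fsuc))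

module DRDFOnSubgraphOfCycle (m : ℕ) (2≤m : 2 ≤ m) (G : Graph (suc m)) (G⊆C : G ⊆ cycle (suc m))
                             (f : Fin (suc m) → ℕ) (f-drdf : IsDRDF G f) where
  open Cycle m 2≤m
  open SubgraphOfCycle m 2≤m G G⊆C

  h : ℕ → ℕ
  h i = f (vertex i)

  weight≡ : weight f ≡ sumTo N h
  weight≡ = weight≡sumTo N f h (λ x → cong f (sym (vertex-toℕ x)))

  h-+N : ∀ i → h (i + N) ≡ h i
  h-+N i = cong f (vertex-+N i)

  h-pred : ∀ i → h (suc i + m) ≡ h i
  h-pred i = trans (cong h (sym (+-suc i m))) (h-+N i)

  window : ∀ i → T (admissible (h i) (h (suc i)) (h (suc (suc i))))
  window i = admissible-weaken {b = h (suc i)} (Data.Sum.map₁ (λ eq → trans eq (h-pred i)) (label-pred-cases f (suc i)))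
               (label-succ-cases f (suc i)) (IsDRDF⇒admissible f f-drdf (suc i))

  open LabelledCycle h (λ i → proj₁ f-drdf (vertex i)) window
  open Periodic N (h-+N 0) (h-+N 1)

  weight≡sumTo-suc : sumTo N (h ∘ suc) ≡ weight f
  weight≡sumTo-suc = trans (sumTo-shift N h (h-+N 0)) (sym weight≡)

  N≤weight : N ≤ weight f
  N≤weight = subst (N ≤_) weight≡sumTo-suc n≤weight

  N<weight : ¬ (N % 2 ≡ 0) → ¬ (N % 3 ≡ 0) → N < weight f
  N<weight N%2≢0 N%3≢0 = subst (N <_) weight≡sumTo-suc (n<weight N%2≢0 N%3≢0)

  module _ (lo l : ℕ) (cut-left : G (vertex lo) (vertex (lo + m)) ≡ false)
           (cut-right : G (vertex (lo + l)) (vertex (suc (lo + l))) ≡ false) where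

    private
      from-lo : ℕ → ℕ
      from-lo j = h (lo + j)

      segment : ℕ → ℕ
      segment = withEnds (suc l) from-lo

      left : ∀ j → j ≤ l → label-pred f (lo + j) ≡ segment j ⊎ label-pred f (lo + j) ≡ 1
      left zero    _     = inj₂ (trans (cong (label-pred f) (+-identityʳ lo)) (if-false _ 1 cut-left))
      left (suc j) 1+j≤l = Data.Sum.map₁
        (λ eq → trans eq (trans (cong (λ k → h (k + m)) (+-suc lo j))
                          (trans (h-pred (lo + j)) (sym (withEnds-in (suc l) from-lo (s≤s (≤-trans (n≤1+n j) 1+j≤l)))))))
        (label-pred-cases f (lo + suc j))

      right : ∀ j → j ≤ l → label-succ f (lo + j) ≡ segment (suc (suc j)) ⊎ label-succ f (lo + j) ≡ 1
      right j j≤l with j <? l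
      ... | yes j<l = Data.Sum.map₁
        (λ eq → trans eq (trans (cong h (sym (+-suc lo j))) (sym (withEnds-in (suc l) from-lo (s≤s j<l)))))
        (label-succ-cases f (lo + j))
      ... | no j≮l with ≤-antisym j≤l (≮⇒≥ j≮l)
      ...   | refl = inj₂ (if-false _ 1 cut-right)

      segment-windows : PathWindows (suc l) from-lo
      segment-windows j (s≤s j≤l) = admissible-weaken {b = segment (suc j)} (left j j≤l) (right j j≤l)
        (subst (λ b → T (admissible (label-pred f (lo + j)) b (label-succ f (lo + j))))
          (sym (withEnds-in (suc l) from-lo (s≤s j≤l))) (IsDRDF⇒admissible f f-drdf (lo + j)))

    γdR-path≤segment : γdR-path (suc l) ≤ sumTo (suc l) (λ j → h (lo + j))
    γdR-path≤segment = γdR-path≤sumTo (suc l) from-lo (λ j _ → proj₁ f-drdf (vertex (lo + j))) segment-windows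

-- Labellings attaining the bounds

module CycleLabelling (m : ℕ) (2≤m : 2 ≤ m) (p : ℕ → ℕ) (p-% : ∀ x → p (x % suc m) ≡ p x)
                      (p-windows : ∀ i → T (admissible (p i) (p (suc i)) (p (suc (suc i))))) where
  open Cycle m 2≤m
  open SubgraphOfCycle m 2≤m C (λ _ _ adj → adj)

  labelling : Fin N → ℕ
  labelling v = p (toℕ v)

  labelling-vertex : ∀ i → labelling (vertex i) ≡ p i
  labelling-vertex i = trans (cong p (toℕ-vertex i)) (p-% i)

  p-+N : ∀ x → p (x + N) ≡ p x
  p-+N x = trans (sym (p-% (x + N))) (trans (cong p ([m+n]%n≡m%n x N)) (p-% x))

  labelling-drdf : IsDRDF C labelling
  labelling-drdf = admissible⇒IsDRDF labelling λ i →
    admissible-weaken {b = labelling (vertex i)}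
      (inj₁ (sym (trans (if-true _ 1 (adj-pred i)) (labelling-vertex (i + m)))))
      (inj₁ (sym (trans (if-true _ 1 (adj-suc i)) (labelling-vertex (suc i)))))
      (subst₂ (λ b c → T (admissible (p (i + m)) b c))
        (trans (cong p (sym (+-suc i m))) (trans (p-+N i) (sym (labelling-vertex i))))
        (trans (cong (p ∘ suc) (sym (+-suc i m))) (p-+N (suc i)))
        (p-windows (i + m)))

  labelling-weight : weight labelling ≡ sumTo N p
  labelling-weight = weight≡sumTo N labelling p (λ _ → refl)

-- The path C_N - {t, t+1} is labelled by p, starting at vertex t + 1 (position 0) and ending
-- at vertex t (position m).
module PathLabelling (m : ℕ) (2≤m : 2 ≤ m) (t : ℕ) (t≤m : t ≤ m) (B : Graph (suc m))
    (B⊆cut : ∀ u v → B u v ≡ true → Between t (suc t % suc m) u v)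
    (p : ℕ → ℕ) (p-windows : PathWindows (suc m) p) where
  open Cycle m 2≤m

  G : Graph N
  G = delete C B

  open SubgraphOfCycle m 2≤m G (delete-⊆ C B)

  position : ℕ → ℕ
  position i = (i + (m ∸ t)) % N

  labelling : Fin N → ℕ
  labelling v = p (position (toℕ v))

  private
    position<N : ∀ i → position i < N
    position<N i = m%n<n (i + (m ∸ t)) N

    position-toℕ : ∀ i → position i ≡ (toℕ (vertex i) + (m ∸ t)) % N
    position-toℕ i = trans ([m+n]%o≡[m%o+n]%o i (m ∸ t) N) (cong (λ z → (z + (m ∸ t)) % N) (sym (toℕ-vertex i)))

    labelling-vertex : ∀ i → labelling (vertex i) ≡ p (position i)
    labelling-vertex i = cong p (sym (position-toℕ i))

    position-t : ∀ i → toℕ (vertex i) ≡ t → position i ≡ m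
    position-t i i≡t = trans (position-toℕ i) (trans (cong (λ z → (z + (m ∸ t)) % N) i≡t)
                         (trans (cong (_% N) (m+[n∸m]≡n t≤m)) (m<n⇒m%n≡m (n<1+n m))))

    position-suc-t : ∀ i → toℕ (vertex i) ≡ suc t % N → position i ≡ 0
    position-suc-t i i≡ = trans (position-toℕ i) (trans (cong (λ z → (z + (m ∸ t)) % N) i≡)
                            (trans (sym ([m+n]%o≡[m%o+n]%o (suc t) (m ∸ t) N))
                            (trans (cong (λ z → suc z % N) (m+[n∸m]≡n t≤m)) (n%n≡0 N))))

    position-suc : ∀ i → position i < m → position (suc i) ≡ suc (position i)
    position-suc i lt = trans (suc-% (i + (m ∸ t)) N) (m<n⇒m%n≡m (s≤s lt))

    position-pred : ∀ i j → position i ≡ suc j → position (i + m) ≡ j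
    position-pred i j eq = begin
        (i + m + (m ∸ t)) % N     ≡⟨ cong (_% N) (trans (+-assoc i m _) (trans (cong (i +_) (+-comm m _)) (sym (+-assoc i _ m)))) ⟩
        (i + (m ∸ t) + m) % N     ≡⟨ [m+n]%o≡[m%o+n]%o (i + (m ∸ t)) m N ⟩
        (position i + m) % N      ≡⟨ cong (λ z → (z + m) % N) eq ⟩
        (suc j + m) % N           ≡⟨ cong (_% N) (sym (+-suc j m)) ⟩
        (j + N) % N               ≡⟨ [m+n]%n≡m%n j N ⟩
        j % N                     ≡⟨ m<n⇒m%n≡m (<-trans (n<1+n j) (subst (_< N) eq (m%n<n (i + (m ∸ t)) N))) ⟩
        j                         ∎
      where open ≡-Reasoning

    m≢1 : m ≢ 1
    m≢1 m≡1 = <-irrefl refl (subst (2 ≤_) m≡1 2≤m)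

    B-succ : ∀ i → position i < m → B (vertex i) (vertex (suc i)) ≡ false
    B-succ i lt with B (vertex i) (vertex (suc i)) in eq
    ... | false = refl
    ... | true with B⊆cut _ _ eq
    ...   | inj₁ (i≡t , _) = ⊥-elim (<-irrefl (position-t i i≡t) lt)
    ...   | inj₂ (1+i≡t , i≡1+t) = ⊥-elim (m≢1 (trans (sym (position-t (suc i) 1+i≡t))
                                     (trans (position-suc i lt) (cong suc (position-suc-t i i≡1+t)))))

    B-pred : ∀ i j → position i ≡ suc j → B (vertex i) (vertex (i + m)) ≡ false
    B-pred i j eq with B (vertex i) (vertex (i + m)) in eq′
    ... | false = refl
    ... | true with B⊆cut _ _ eq′
    ...   | inj₁ (i≡t , i+m≡1+t) = ⊥-elim (m≢1 (trans (sym (position-t i i≡t))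
                                     (trans eq (cong suc (trans (sym (position-pred i j eq)) (position-suc-t (i + m) i+m≡1+t))))))
    ...   | inj₂ (_ , i≡1+t) = ⊥-elim (0≢1+n (trans (sym (position-suc-t i i≡1+t)) eq))

    present : ∀ {u v} → Adj C u v → B u v ≡ false → Adj G u v
    present {u} {v} adj notB rewrite adj | notB = refl

    left : ∀ i → withEnds N p (position i) ≡ label-pred labelling i ⊎ withEnds N p (position i) ≡ 1
    left i with position i in eq
    ... | zero   = inj₂ refl
    ... | suc j  = inj₁ (trans (withEnds-in N p (<-trans (n<1+n j) (subst (_< N) eq (position<N i))))
                          (sym (trans (if-true _ 1 (present (adj-pred i) (B-pred i j eq)))
                                      (trans (labelling-vertex (i + m)) (cong p (position-pred i j eq))))))

    right : ∀ i → withEnds N p (suc (suc (position i))) ≡ label-succ labelling i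
                ⊎ withEnds N p (suc (suc (position i))) ≡ 1
    right i with position i <? m
    ... | yes lt = inj₁ (trans (withEnds-in N p (s≤s lt))
                          (sym (trans (if-true _ 1 (present (adj-suc i) (B-succ i lt)))
                                      (trans (labelling-vertex (suc i)) (cong p (position-suc i lt))))))
    ... | no ≮m with ≤-antisym (≤-pred (m%n<n (i + (m ∸ t)) N)) (≮⇒≥ ≮m)
    ...   | eq = inj₂ (trans (cong (λ z → withEnds N p (suc (suc z))) eq) (withEnds-out N p))

  labelling-drdf : IsDRDF G labelling
  labelling-drdf = admissible⇒IsDRDF labelling λ i →
    admissible-weaken {b = labelling (vertex i)} (left i) (right i)
      (subst (λ b → T (admissible (withEnds N p (position i)) b (withEnds N p (suc (suc (position i))))))
        (trans (withEnds-in N p (position<N i)) (sym (labelling-vertex i)))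
        (p-windows (position i) (position<N i)))

  labelling-weight : weight labelling ≡ sumTo N p
  labelling-weight = trans (weight≡sumTo N labelling (λ i → p ((i + (m ∸ t)) % N)) (λ _ → refl))
    (trans (sumTo-rotate N (λ i → p (i % N)) (λ i → cong p ([m+n]%n≡m%n i N)) (m ∸ t))
           (sumTo-cong N (λ i lt → cong p (m<n⇒m%n≡m lt))))

alternating : ℕ → ℕ
alternating zero          = 2
alternating (suc zero)    = 0
alternating (suc (suc j)) = alternating j

alternating-windows : ∀ i → T (admissible (alternating i) (alternating (suc i)) (alternating (suc (suc i))))
alternating-windows zero          = tt
alternating-windows (suc zero)    = tt
alternating-windows (suc (suc i)) = alternating-windows i

alternating-+2k : ∀ k r → alternating (k * 2 + r) ≡ alternating r
alternating-+2k zero    r = refl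
alternating-+2k (suc k) r = alternating-+2k k r

alternating-%2 : ∀ x → alternating (x % 2) ≡ alternating x
alternating-%2 x = trans (sym (alternating-+2k (x / 2) (x % 2)))
                     (cong alternating (trans (+-comm (x / 2 * 2) (x % 2)) (sym (m≡m%n+[m/n]*n x 2))))

alternating-% : ∀ n .{{_ : NonZero n}} → 2 ∣ n → ∀ x → alternating (x % n) ≡ alternating x
alternating-% n 2∣n x = trans (sym (alternating-%2 (x % n)))
                         (trans (cong alternating (m∣n⇒o%n%m≡o%m 2 n x 2∣n)) (alternating-%2 x))

sumTo-alternating : ∀ k → sumTo (k * 2) alternating ≡ k * 2
sumTo-alternating zero    = refl
sumTo-alternating (suc k) = cong (2 +_) (sumTo-alternating k)

blocks : ℕ → ℕ
blocks zero                = 0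
blocks (suc zero)          = 3
blocks (suc (suc zero))    = 0
blocks (suc (suc (suc j))) = blocks j

blocks-windows : ∀ i → T (admissible (blocks i) (blocks (suc i)) (blocks (suc (suc i))))
blocks-windows zero                = tt
blocks-windows (suc zero)          = tt
blocks-windows (suc (suc zero))    = tt
blocks-windows (suc (suc (suc i))) = blocks-windows i

blocks-+3k : ∀ r k → blocks (r + k * 3) ≡ blocks r
blocks-+3k r k = trans (cong blocks (+-comm r (k * 3))) (periodic k)
  where
  periodic : ∀ k → blocks (k * 3 + r) ≡ blocks r
  periodic zero    = refl
  periodic (suc k) = periodic k

sumTo-blocks : ∀ k → sumTo (k * 3) blocks ≡ k * 3
sumTo-blocks zero    = refl
sumTo-blocks (suc k) = cong (3 +_) (sumTo-blocks k)

sumTo-blocks-+2 : ∀ k → sumTo (2 + k * 3) blocks ≡ 3 + k * 3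
sumTo-blocks-+2 zero    = refl
sumTo-blocks-+2 (suc k) = cong (3 +_) (sumTo-blocks-+2 k)

twoThenBlocks : ℕ → ℕ
twoThenBlocks zero    = 2
twoThenBlocks (suc j) = blocks j

pathWindows-intro : ∀ l p → (∀ i → T (admissible (p i) (p (suc i)) (p (suc (suc i))))) →
                    T (admissible 1 (p 0) (p 1)) → T (admissible (p l) (p (suc l)) 1) →
                    PathWindows (suc (suc l)) p
pathWindows-intro l p inner first last zero    _           = first
pathWindows-intro l p inner first last (suc j) (s≤s 1+j≤1+l) with j <? l
... | yes j<l = subst₂ (λ a b → T (admissible a b (withEnds (suc (suc l)) p (suc (suc (suc j))))))
                  (sym (withEnds-in (suc (suc l)) p (≤-trans (s≤s (n≤1+n j)) (s≤s 1+j≤1+l))))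
                  (sym (withEnds-in (suc (suc l)) p (s≤s 1+j≤1+l)))
                  (subst (λ c → T (admissible (p j) (p (suc j)) c))
                    (sym (withEnds-in (suc (suc l)) p (s≤s (s≤s j<l)))) (inner j))
... | no j≮l with ≤-antisym (≤-pred 1+j≤1+l) (≮⇒≥ j≮l)
...   | refl = subst₂ (λ a b → T (admissible a b (withEnds (suc (suc l)) p (suc (suc (suc l))))))
                  (sym (withEnds-in (suc (suc l)) p (≤-trans (n<1+n l) (n≤1+n _))))
                  (sym (withEnds-in (suc (suc l)) p (n<1+n (suc l))))
                  (subst (λ c → T (admissible (p l) (p (suc l)) c)) (sym (withEnds-out (suc (suc l)) p)) last)

twoThenBlocks-windows : ∀ i → T (admissible (twoThenBlocks i) (twoThenBlocks (suc i)) (twoThenBlocks (suc (suc i))))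
twoThenBlocks-windows zero    = tt
twoThenBlocks-windows (suc i) = blocks-windows i

γdR-path-+3k : ∀ r k → γdR-path (r + k * 3) ≡ r + k * 3 + (if r % 3 ≡ᵇ 0 then 0 else 1)
γdR-path-+3k r k = cong (λ x → r + k * 3 + (if x ≡ᵇ 0 then 0 else 1)) ([m+kn]%n≡m%n r k 3)

LabelsPath : ℕ → (ℕ → ℕ) → Set
LabelsPath l p = PathWindows l p × sumTo l p ≡ γdR-path l

blocks-labels-path₀ : ∀ k → LabelsPath (3 + k * 3) blocks
blocks-labels-path₀ k = pathWindows-intro (1 + k * 3) blocks blocks-windows tt last ,
                        trans (sumTo-blocks (suc k)) (sym (trans (γdR-path-+3k 0 (suc k)) (+-identityʳ _)))
  where
  last : T (admissible (blocks (1 + k * 3)) (blocks (2 + k * 3)) 1)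
  last rewrite blocks-+3k 1 k | blocks-+3k 2 k = tt

twoThenBlocks-labels-path₁ : ∀ k → LabelsPath (4 + k * 3) twoThenBlocks
twoThenBlocks-labels-path₁ k = pathWindows-intro (2 + k * 3) twoThenBlocks twoThenBlocks-windows tt last ,
                               trans (cong (2 +_) (sumTo-blocks (suc k)))
                                     (sym (trans (γdR-path-+3k 1 (suc k)) (+-comm (4 + k * 3) 1)))
  where
  last : T (admissible (blocks (1 + k * 3)) (blocks (2 + k * 3)) 1)
  last rewrite blocks-+3k 1 k | blocks-+3k 2 k = tt

blocks-labels-path₂ : ∀ k → LabelsPath (2 + k * 3) blocks
blocks-labels-path₂ k = pathWindows-intro (k * 3) blocks blocks-windows tt last ,
                        trans (sumTo-blocks-+2 k) (sym (trans (γdR-path-+3k 2 k) (+-comm (2 + k * 3) 1)))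
  where
  last : T (admissible (blocks (k * 3)) (blocks (1 + k * 3)) 1)
  last rewrite blocks-+3k 0 k | blocks-+3k 1 k = tt

path-labelling : ∀ l → 2 ≤ l → Σ (ℕ → ℕ) (LabelsPath l)
path-labelling = by-residue-3 (λ l → 2 ≤ l → Σ (ℕ → ℕ) (LabelsPath l))
  (λ { zero () ; (suc k) _ → blocks , blocks-labels-path₀ k })
  (λ { zero (s≤s ()) ; (suc k) _ → twoThenBlocks , twoThenBlocks-labels-path₁ k })
  (λ k _ → blocks , blocks-labels-path₂ k)

-- The two cuts leave a path on one vertex (two if N ≡ 1 mod 3) and the rest of the cycle.
split-exceeds : ∀ m → 2 ≤ m → Σ ℕ λ k → Σ ℕ λ l → suc k + l ≡ m × suc k < m ×
                γdR-path (suc m) < γdR-path (suc k) + γdR-path (suc l)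
split-exceeds = by-residue-3 (λ m → 2 ≤ m → Σ ℕ λ k → Σ ℕ λ l → suc k + l ≡ m × suc k < m ×
                                   γdR-path (suc m) < γdR-path (suc k) + γdR-path (suc l))
  (λ { zero () ; (suc q) _ → 1 , 1 + q * 3 , refl , s≤s (s≤s (s≤s z≤n)) , N≡1 q })
  (λ { zero (s≤s ()) ; (suc q) _ → 0 , 3 + q * 3 , refl , s≤s (s≤s z≤n) , N≡2 q })
  (λ q _ → 0 , 1 + q * 3 , refl , s≤s (s≤s z≤n) , N≡0 q)
  where
  N≡1 : ∀ q → γdR-path (4 + q * 3) < γdR-path 2 + γdR-path (2 + q * 3)
  N≡1 q rewrite γdR-path-+3k 4 q | γdR-path-+3k 2 q = ≤-refl
  N≡2 : ∀ q → γdR-path (5 + q * 3) < γdR-path 1 + γdR-path (4 + q * 3)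
  N≡2 q rewrite γdR-path-+3k 5 q | γdR-path-+3k 4 q = ≤-refl
  N≡0 : ∀ q → γdR-path (3 + q * 3) < γdR-path 1 + γdR-path (2 + q * 3)
  N≡0 q rewrite γdR-path-+3k 3 q | γdR-path-+3k 2 q = s≤s (s≤s (s≤s (s≤s (+-monoʳ-≤ (q * 3) z≤n))))

≢true⇒≡false : ∀ {x} → (x ≡ true → ⊥) → x ≡ false
≢true⇒≡false {false} _       = refl
≢true⇒≡false {true}  x≢true = ⊥-elim (x≢true refl)

ind : Bool → ℕ
ind true  = 1
ind false = 0

module Counting (m : ℕ) (B : Graph (suc m)) where
  open Positions m

  countsAt : Fin N × Fin N → ℕ
  countsAt (u , v) = ind ((toℕ u <ᵇ toℕ v) ∧ B u v)

  private
    count : List (Fin N × Fin N) → ℕ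
    count []       = 0
    count (p ∷ ps) = countsAt p + count ps

    length-filter : ∀ ps → length (filter (λ p → 1 ≤? (if B (proj₁ p) (proj₂ p) then 1 else 0))
                                     (filter (λ p → toℕ (proj₁ p) <? toℕ (proj₂ p)) ps)) ≡ count ps
    length-filter [] = refl
    length-filter ((u , v) ∷ ps) with toℕ u <ᵇ toℕ v
    ... | false = length-filter ps
    ... | true with B u v
    ...   | false = length-filter ps
    ...   | true  = cong suc (length-filter ps)

    count-++ : ∀ ps qs → count (ps ++ qs) ≡ count ps + count qs
    count-++ []       qs = refl
    count-++ (p ∷ ps) qs = trans (cong (countsAt p +_) (count-++ ps qs)) (sym (+-assoc (countsAt p) _ _))

    count-tabulate : ∀ k (g : Fin k → Fin N × Fin N) (c : ℕ → ℕ) → (∀ x → countsAt (g x) ≡ c (toℕ x)) →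
                     count (tabulate g) ≡ sumTo k c
    count-tabulate zero    g c eq = refl
    count-tabulate (suc k) g c eq = cong₂ _+_ (eq fzero) (count-tabulate k (g ∘ fsuc) (c ∘ suc) (eq ∘ fsuc))

    count-concatMap : ∀ k (g : Fin k → Fin N) (F : Fin N → List (Fin N × Fin N)) (c : ℕ → ℕ) →
                      (∀ x → count (F (g x)) ≡ c (toℕ x)) → count (concatMap F (tabulate g)) ≡ sumTo k c
    count-concatMap zero    g F c eq = refl
    count-concatMap (suc k) g F c eq =
      trans (count-++ (F (g fzero)) _) (cong₂ _+_ (eq fzero) (count-concatMap k (g ∘ fsuc) F (c ∘ suc) (eq ∘ fsuc)))

  countsAt-positions : ℕ → ℕ → ℕ
  countsAt-positions a b = countsAt (vertex a , vertex b)

  card≡sumTo : card B ≡ sumTo N (λ a → sumTo N (countsAt-positions a))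
  card≡sumTo = trans (length-filter (concatMap (λ u → map (u ,_) (allFin N)) (allFin N)))
    (count-concatMap N id (λ u → map (u ,_) (allFin N)) (λ a → sumTo N (countsAt-positions a)) λ u →
      trans (cong count (map-tabulate id (u ,_)))
        (trans (count-tabulate N (u ,_) (λ b → countsAt (u , vertex b))
                                 (λ v → cong (λ w → countsAt (u , w)) (sym (vertex-toℕ v))))
               (sumTo-cong N (λ b _ → cong (λ w → countsAt (w , vertex b)) (sym (vertex-toℕ u))))))

  countsAt-< : ∀ a b → a < N → b < N → a < b → countsAt-positions a b ≡ ind (B (vertex a) (vertex b))
  countsAt-< a b a<N b<N a<b rewrite toℕ-vertex-< a a<N | toℕ-vertex-< b b<N | Equivalence.to T-≡ (<⇒<ᵇ a<b) = refl

  private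
    countsAt-≮ : ∀ a b → a < N → b < N → ¬ a < b → countsAt-positions a b ≡ 0
    countsAt-≮ a b a<N b<N a≮b rewrite toℕ-vertex-< a a<N | toℕ-vertex-< b b<N with a <ᵇ b in a<ᵇb
    ... | false = refl
    ... | true  = ⊥-elim (a≮b (<ᵇ⇒< a b (subst T (sym a<ᵇb) _)))

    countsAt≡1 : ∀ a b → a < N → b < N → countsAt-positions a b ≡ 1 → a < b × B (vertex a) (vertex b) ≡ true
    countsAt≡1 a b a<N b<N c≡1 with a <? b
    ... | no a≮b = ⊥-elim (0≢1+n (trans (sym (countsAt-≮ a b a<N b<N a≮b)) c≡1))
    ... | yes a<b = a<b , ind≡1 (trans (sym (countsAt-< a b a<N b<N a<b)) c≡1)
      where
      ind≡1 : ∀ {x} → ind x ≡ 1 → x ≡ true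
      ind≡1 {true} _ = refl

  countsAt-≡0 : ∀ a b → a < N → b < N → (a < b → B (vertex a) (vertex b) ≡ true → ⊥) → countsAt-positions a b ≡ 0
  countsAt-≡0 a b a<N b<N never with a <? b
  ... | no a≮b  = countsAt-≮ a b a<N b<N a≮b
  ... | yes a<b = trans (countsAt-< a b a<N b<N a<b) (cong ind (≢true⇒≡false (never a<b)))

  module _ (B-sym : ∀ u v → B u v ≡ B v u) (B-irr : ∀ u → B u u ≡ false) where

    private
      oriented : ∀ u v → B u v ≡ true →
                 Σ ℕ λ a → Σ ℕ λ b → a < b × b < N × countsAt-positions a b ≡ 1 × Between a b u v
      oriented u v Buv with toℕ u <? toℕ v | toℕ v <? toℕ u
      ... | yes u<v | _ = toℕ u , toℕ v , u<v , toℕ<n v ,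
            trans (countsAt-< _ _ (toℕ<n u) (toℕ<n v) u<v)
              (cong ind (subst₂ (λ x y → B x y ≡ true) (sym (vertex-toℕ u)) (sym (vertex-toℕ v)) Buv)) ,
            inj₁ (refl , refl)
      ... | no _ | yes v<u = toℕ v , toℕ u , v<u , toℕ<n u ,
            trans (countsAt-< _ _ (toℕ<n v) (toℕ<n u) v<u)
              (cong ind (subst₂ (λ x y → B x y ≡ true) (sym (vertex-toℕ v)) (sym (vertex-toℕ u)) (trans (B-sym v u) Buv))) ,
            inj₂ (refl , refl)
      ... | no u≮v | no v≮u with toℕ-injective (≤-antisym (≮⇒≥ v≮u) (≮⇒≥ u≮v))
      ...   | refl = ⊥-elim (false≢true (trans (sym (B-irr u)) Buv))
        where
        false≢true : false ≢ true
        false≢true ()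

    card≡0⇒ : card B ≡ 0 → ∀ u v → B u v ≡ false
    card≡0⇒ card≡0 u v with B u v in Buv
    ... | false = refl
    ... | true with oriented u v Buv
    ...   | a , b , a<b , b<N , c≡1 , _ = ⊥-elim (0≢1+n (trans (sym cell≡0) c≡1))
      where
      row≡0 = sumTo≡0⇒ N (λ a → sumTo N (countsAt-positions a)) (trans (sym card≡sumTo) card≡0) a (<-trans a<b b<N)
      cell≡0 = sumTo≡0⇒ N (countsAt-positions a) row≡0 b b<N

    card≡1⇒ : card B ≡ 1 → Σ ℕ λ a → Σ ℕ λ b → a < b × b < N × B (vertex a) (vertex b) ≡ true ×
                                   (∀ u v → B u v ≡ true → Between a b u v)
    card≡1⇒ card≡1 with sumTo≡1⇒ N (λ a → sumTo N (countsAt-positions a)) (trans (sym card≡sumTo) card≡1)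
    ... | a , a<N , row≡1 , other-rows with sumTo≡1⇒ N (countsAt-positions a) row≡1
    ... | b , b<N , c≡1 , other-columns = a , b , a<b , b<N , Bab , only
      where
      a<b = proj₁ (countsAt≡1 a b a<N b<N c≡1)
      Bab = proj₂ (countsAt≡1 a b a<N b<N c≡1)
      only : ∀ u v → B u v ≡ true → Between a b u v
      only u v Buv with oriented u v Buv
      ... | a′ , b′ , a′<b′ , b′<N , c′≡1 , between with a′ ≟ a
      ...   | no a′≢a = ⊥-elim (0≢1+n (trans (sym cell≡0) c′≡1))
        where cell≡0 = sumTo≡0⇒ N (countsAt-positions a′) (other-rows a′ (<-trans a′<b′ b′<N) a′≢a) b′ b′<N
      ...   | yes refl with b′ ≟ b
      ...     | no b′≢b = ⊥-elim (0≢1+n (trans (sym (other-columns b′ b′<N b′≢b)) c′≡1))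
      ...     | yes refl = between

_∪_ : ∀ {n} → Graph n → Graph n → Graph n
(B ∪ B′) u v = B u v ∨ B′ u v

∪-introˡ : ∀ {n} (B B′ : Graph n) u v → B u v ≡ true → (B ∪ B′) u v ≡ true
∪-introˡ B B′ u v Buv = ∨-introˡ Buv

∪-introʳ : ∀ {n} (B B′ : Graph n) u v → B′ u v ≡ true → (B ∪ B′) u v ≡ true
∪-introʳ B B′ u v B′uv = ∨-introʳ {B u v} B′uv

card-∪ : ∀ m (B B′ : Graph (suc m)) → (∀ u v → B u v ≡ true → B′ u v ≡ true → ⊥) →
         card (B ∪ B′) ≡ card B + card B′
card-∪ m B B′ disjoint = begin
    card (B ∪ B′)                             ≡⟨ Counting.card≡sumTo m (B ∪ B′) ⟩
    sumTo N (λ a → sumTo N (cells (B ∪ B′) a)) ≡⟨ sumTo-cong N (λ a _ → trans (sumTo-cong N (λ b _ → split a b))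
                                                                        (sumTo-distrib N (cells B a) (cells B′ a))) ⟩
    sumTo N (λ a → rows B a + rows B′ a)      ≡⟨ sumTo-distrib N (rows B) (rows B′) ⟩
    sumTo N (rows B) + sumTo N (rows B′)      ≡⟨ sym (cong₂ _+_ (Counting.card≡sumTo m B) (Counting.card≡sumTo m B′)) ⟩
    card B + card B′                          ∎
  where
  open ≡-Reasoning
  open Positions m
  cells : Graph N → ℕ → ℕ → ℕ
  cells = Counting.countsAt-positions m
  rows : Graph N → ℕ → ℕ
  rows B a = sumTo N (cells B a)
  ind-∧-∨ : ∀ t x y → (x ≡ true → y ≡ true → ⊥) → ind (t ∧ (x ∨ y)) ≡ ind (t ∧ x) + ind (t ∧ y)
  ind-∧-∨ false x     y     _  = refl
  ind-∧-∨ true  true  true  xy = ⊥-elim (xy refl refl)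
  ind-∧-∨ true  true  false _  = refl
  ind-∧-∨ true  false y     _  = refl
  split : ∀ a b → cells (B ∪ B′) a b ≡ cells B a b + cells B′ a b
  split a b = ind-∧-∨ (toℕ (vertex a) <ᵇ toℕ (vertex b)) _ _ (disjoint (vertex a) (vertex b))

edge : ∀ {n} → ℕ → ℕ → Graph n
edge a b u v = ((toℕ u ≡ᵇ a) ∧ (toℕ v ≡ᵇ b)) ∨ ((toℕ u ≡ᵇ b) ∧ (toℕ v ≡ᵇ a))

edge⇒Between : ∀ {n} a b (u v : Fin n) → edge a b u v ≡ true → Between a b u v
edge⇒Between a b u v uv with Equivalence.to T-∨ (Equivalence.from T-≡ uv)
... | inj₁ ab = let (u≡ , v≡) = Equivalence.to T-∧ ab in inj₁ (≡ᵇ⇒≡ _ a u≡ , ≡ᵇ⇒≡ _ b v≡)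
... | inj₂ ba = let (u≡ , v≡) = Equivalence.to T-∧ ba in inj₂ (≡ᵇ⇒≡ _ a v≡ , ≡ᵇ⇒≡ _ b u≡)

Between⇒edge : ∀ {n} a b (u v : Fin n) → Between a b u v → edge a b u v ≡ true
Between⇒edge a b u v between = Equivalence.to T-≡ (Equivalence.from T-∨ (Data.Sum.map
  (λ (u≡ , v≡) → Equivalence.from T-∧ (≡⇒≡ᵇ _ a u≡ , ≡⇒≡ᵇ _ b v≡))
  (λ (v≡ , u≡) → Equivalence.from T-∧ (≡⇒≡ᵇ _ b u≡ , ≡⇒≡ᵇ _ a v≡)) between))

edge-sym : ∀ {n} a b (u v : Fin n) → edge a b u v ≡ edge a b v u
edge-sym a b u v = trans (∨-comm ((toℕ u ≡ᵇ a) ∧ (toℕ v ≡ᵇ b)) _)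
  (cong₂ _∨_ (∧-comm (toℕ u ≡ᵇ b) (toℕ v ≡ᵇ a)) (∧-comm (toℕ u ≡ᵇ a) (toℕ v ≡ᵇ b)))

card-edge : ∀ m a b → a < b → b < suc m → card {suc m} (edge a b) ≡ 1
card-edge m a b a<b b<N = begin
    card {N} (edge a b)                               ≡⟨ card≡sumTo ⟩
    sumTo N (λ x → sumTo N (countsAt-positions x))    ≡⟨ sumTo-single N _ a a<N other-rows ⟩
    sumTo N (countsAt-positions a)                    ≡⟨ sumTo-single N _ b b<N other-columns ⟩
    countsAt-positions a b                            ≡⟨ countsAt-< a b a<N b<N a<b ⟩
    ind (edge a b (vertex a) (vertex b))              ≡⟨ cong ind (Between⇒edge a b _ _ (inj₁ (toℕ-vertex-< a a<N , toℕ-vertex-< b b<N))) ⟩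
    1                                                 ∎
  where
  open ≡-Reasoning
  open Positions m
  open Counting m (edge a b)
  a<N = <-trans a<b b<N
  position-of : ∀ x y → x < N → y < N → x < y → edge a b (vertex x) (vertex y) ≡ true → x ≡ a × y ≡ b
  position-of x y x<N y<N x<y e with edge⇒Between a b _ _ e
  ... | inj₁ (x≡ , y≡) = trans (sym (toℕ-vertex-< x x<N)) x≡ , trans (sym (toℕ-vertex-< y y<N)) y≡
  ... | inj₂ (y≡ , x≡) = ⊥-elim (<-asym a<b
                           (subst₂ _<_ (trans (sym (toℕ-vertex-< x x<N)) x≡) (trans (sym (toℕ-vertex-< y y<N)) y≡) x<y))
  other-rows : ∀ x → x < N → x ≢ a → sumTo N (countsAt-positions x) ≡ 0
  other-rows x x<N x≢a = sumTo-zero N _ λ y y<N →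
    countsAt-≡0 x y x<N y<N (λ x<y e → x≢a (proj₁ (position-of x y x<N y<N x<y e)))
  other-columns : ∀ y → y < N → y ≢ b → countsAt-positions a y ≡ 0
  other-columns y y<N y≢b = countsAt-≡0 a y a<N y<N (λ a<y e → y≢b (proj₂ (position-of a y a<N y<N a<y e)))

-- The bondage number of C_N

HasDRDFOfWeight : ∀ {n} → Graph n → ℕ → Set
HasDRDFOfWeight G k = ∃[ f ] (IsDRDF G f × weight f ≡ k)

increases-intro : ∀ {n} {G B : Graph n} {γ} → IsγdR G γ → (∀ f → IsDRDF (delete G B) f → γ < weight f) → Increases G B
increases-intro ((g , g-drdf , g-weight) , _) heavier k k′ (_ , k-min) ((f′ , f′-drdf , f′-weight) , _) =
  ≤-<-trans (subst (k ≤_) g-weight (k-min g g-drdf)) (subst (_ <_) f′-weight (heavier f′ f′-drdf))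

¬increases : ∀ {n} {G B : Graph n} {γ} → IsγdR G γ → IsγdR (delete G B) γ → ¬ Increases G B
¬increases {γ = γ} γG γG-B increases = <-irrefl refl (increases γ γ γG γG-B)

delete-∅ : ∀ {n} (G B : Graph n) → (∀ u v → B u v ≡ false) → ∀ u v → delete G B u v ≡ G u v
delete-∅ G B B≡∅ u v = trans (cong (λ b → G u v ∧ not b) (B≡∅ u v)) (∧-identityʳ (G u v))

IsγdR-≗ : ∀ {n} {G H : Graph n} {k} → (∀ u v → G u v ≡ H u v) → IsγdR G k → IsγdR H k
IsγdR-≗ G≗H ((f , f-drdf , f-weight) , k-min) =
  (f , IsDRDF-mono (λ u v → trans (sym (G≗H u v))) f-drdf , f-weight) ,
  (λ g g-drdf → k-min g (IsDRDF-mono (λ u v → trans (G≗H u v)) g-drdf))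

module CycleBondage (m : ℕ) (2≤m : 2 ≤ m) where
  open Cycle m 2≤m

  C-minus-cut : ∀ t → t ≤ m → ∀ B → (∀ u v → B u v ≡ true → Between t (suc t % N) u v) →
                HasDRDFOfWeight (delete C B) (γdR-path N)
  C-minus-cut t t≤m B B⊆cut with path-labelling N (s≤s (≤-trans (s≤s z≤n) 2≤m))
  ... | p , p-windows , p-weight = labelling , labelling-drdf , trans labelling-weight p-weight
    where open PathLabelling m 2≤m t t≤m B B⊆cut p p-windows

  C-path : HasDRDFOfWeight C (γdR-path N)
  C-path with C-minus-cut m ≤-refl (λ _ _ → false) (λ _ _ ())
  ... | f , f-drdf , f-weight = f , IsDRDF-mono (delete-⊆ C (λ _ _ → false)) f-drdf , f-weight

  C-even : N % 2 ≡ 0 → HasDRDFOfWeight C N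
  C-even N%2≡0 = labelling , labelling-drdf , (begin
      weight labelling              ≡⟨ labelling-weight ⟩
      sumTo N alternating           ≡⟨ cong (λ n → sumTo n alternating) N≡ ⟩
      sumTo (N / 2 * 2) alternating ≡⟨ sumTo-alternating (N / 2) ⟩
      N / 2 * 2                     ≡⟨ sym N≡ ⟩
      N                             ∎)
    where
    open ≡-Reasoning
    N≡ : N ≡ N / 2 * 2
    N≡ = trans (m≡m%n+[m/n]*n N 2) (cong (_+ N / 2 * 2) N%2≡0)
    open CycleLabelling m 2≤m alternating (alternating-% N (divides (N / 2) N≡)) alternating-windows

  module CycleBound = DRDFOnSubgraphOfCycle m 2≤m C (λ _ _ adj → adj)

  γdR-C-even : N % 2 ≡ 0 → IsγdR C N
  γdR-C-even N%2≡0 = C-even N%2≡0 , CycleBound.N≤weight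

  γdR-C-path : N % 3 ≡ 0 ⊎ ¬ (N % 2 ≡ 0) → IsγdR C (γdR-path N)
  γdR-C-path cond = C-path , lower
    where
    lower : ∀ f → IsDRDF C f → γdR-path N ≤ weight f
    lower f f-drdf with N % 3 ≟ 0
    ... | yes N%3≡0 = subst (_≤ weight f) (sym (γdR-path-0 N N%3≡0)) (CycleBound.N≤weight f f-drdf)
    ... | no  N%3≢0 = subst (_≤ weight f) (sym (γdR-path-≢0 N N%3≢0))
                        (CycleBound.N<weight f f-drdf odd N%3≢0)
      where
      odd : ¬ (N % 2 ≡ 0)
      odd = [ (λ N%3≡0 → ⊥-elim (N%3≢0 N%3≡0)) , (λ odd → odd) ]′ cond

  private
    B-irreflexive : ∀ {B} → IsEdgeSubset C B → ∀ u → B u u ≡ false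
    B-irreflexive (_ , B⊆C) u = ≢true⇒≡false (λ Buu → C-irreflexive u (B⊆C u u Buu))

    Between-swap : ∀ {a b} {u v : Fin N} → Between a b u v → Between b a u v
    Between-swap (inj₁ (u≡a , v≡b)) = inj₂ (v≡b , u≡a)
    Between-swap (inj₂ (v≡a , u≡b)) = inj₁ (u≡b , v≡a)

  ¬increases-card0 : ∀ {γ} B → IsEdgeSubset C B → card B ≡ 0 → IsγdR C γ → ¬ Increases C B
  ¬increases-card0 B B⊆C card≡0 γC = ¬increases γC (IsγdR-≗ (λ u v → sym (delete-∅ C B B≡∅ u v)) γC)
    where B≡∅ = Counting.card≡0⇒ m B (proj₁ B⊆C) (B-irreflexive B⊆C) card≡0

  adjacent⇒cut : ∀ a b → a < b → b < N → vertex b ≡ vertex (suc a) ⊎ vertex b ≡ vertex (a + m) →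
                 Σ ℕ λ t → t ≤ m × (∀ (u v : Fin N) → Between a b u v → Between t (suc t % N) u v)
  adjacent⇒cut a b a<b b<N (inj₁ b-succ) = a , ≤-pred (<-trans a<b b<N) , λ u v → subst (λ x → Between a x u v) b≡
    where
    b≡ : b ≡ suc a % N
    b≡ = trans (sym (toℕ-vertex-< b b<N)) (trans (cong toℕ b-succ) (toℕ-vertex (suc a)))
  adjacent⇒cut a b a<b b<N (inj₂ b-pred) = b , ≤-pred b<N , λ u v → Between-swap ∘ subst (λ x → Between x b u v) (sym a≡)
    where
    open ≡-Reasoning
    a≡ : suc b % N ≡ a
    a≡ = begin
      suc b % N                  ≡⟨ cong (λ x → suc x % N) (trans (sym (toℕ-vertex-< b b<N))
                                                                  (trans (cong toℕ b-pred) (toℕ-vertex (a + m)))) ⟩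
      suc ((a + m) % N) % N      ≡⟨ sym (suc-% (a + m) N) ⟩
      suc (a + m) % N            ≡⟨ pred-suc a ⟩
      a % N                      ≡⟨ m<n⇒m%n≡m (<-trans a<b b<N) ⟩
      a                          ∎

  card1⇒cut : ∀ B → IsEdgeSubset C B → card B ≡ 1 →
              Σ ℕ λ t → t ≤ m × (∀ u v → B u v ≡ true → Between t (suc t % N) u v)
  card1⇒cut B B⊆C card≡1 =
    let (a , b , a<b , b<N , Bab , only) = Counting.card≡1⇒ m B (proj₁ B⊆C) (B-irreflexive B⊆C) card≡1
        (t , t≤m , cut) = adjacent⇒cut a b a<b b<N (neighbours a (vertex b) (proj₂ B⊆C _ _ Bab))
    in t , t≤m , λ u v Buv → cut u v (only u v Buv)

  ¬increases-card1 : ∀ B → IsEdgeSubset C B → card B ≡ 1 → IsγdR C (γdR-path N) → ¬ Increases C B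
  ¬increases-card1 B B⊆C card≡1 γC =
    let (t , t≤m , B⊆cut) = card1⇒cut B B⊆C card≡1
    in ¬increases {G = C} {B = B} γC
         (C-minus-cut t t≤m B B⊆cut , λ f f-drdf → proj₂ γC f (IsDRDF-mono (delete-⊆ C B) f-drdf))

  private
    at-position : ∀ {a} (u : Fin N) → toℕ u ≡ a → u ≡ vertex a
    at-position u u≡a = trans (sym (vertex-toℕ u)) (cong vertex u≡a)

    edge-⊆C : ∀ a b → Adj C (vertex a) (vertex b) → IsEdgeSubset C (edge a b)
    edge-⊆C a b adj = edge-sym a b , λ u v e → edge-adj u v (edge⇒Between a b u v e)
      where
      edge-adj : ∀ u v → Between a b u v → Adj C u v
      edge-adj u v (inj₁ (u≡a , v≡b)) = subst₂ (Adj C) (sym (at-position u u≡a)) (sym (at-position v v≡b)) adj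
      edge-adj u v (inj₂ (v≡a , u≡b)) = trans (C-sym u v) (subst₂ (Adj C) (sym (at-position v v≡a)) (sym (at-position u u≡b)) adj)

    ∪-⊆ : ∀ {B B′} → IsEdgeSubset C B → IsEdgeSubset C B′ → IsEdgeSubset C (B ∪ B′)
    ∪-⊆ {B} {B′} (B-sym , B⊆C) (B′-sym , B′⊆C) = (λ u v → cong₂ _∨_ (B-sym u v) (B′-sym u v)) ,
      λ u v e → [ B⊆C u v , B′⊆C u v ]′ (∨-true (B u v) (B′ u v) e)

    delete-cut : ∀ B u v → B u v ≡ true → delete C B u v ≡ false
    delete-cut B u v Buv = trans (cong (λ b → C u v ∧ not b) Buv) (∧-zeroʳ (C u v))

    toℕ-vertex-m+1 : toℕ (vertex (suc m)) ≡ 0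
    toℕ-vertex-m+1 = trans (toℕ-vertex (suc m)) (n%n≡0 N)

  wrap : Graph N
  wrap = edge 0 m

  wrap-⊆C : IsEdgeSubset C wrap
  wrap-⊆C = edge-⊆C 0 m (adj-pred 0)

  wrap-left : wrap (vertex 0) (vertex (0 + m)) ≡ true
  wrap-left = Between⇒edge 0 m _ _ (inj₁ (toℕ-vertex-< 0 (s≤s z≤n) , toℕ-vertex-< m (n<1+n m)))

  wrap-right : wrap (vertex m) (vertex (suc m)) ≡ true
  wrap-right = Between⇒edge 0 m _ _ (inj₂ (toℕ-vertex-m+1 , toℕ-vertex-< m (n<1+n m)))

  minus-wrap-bound : ∀ f → IsDRDF (delete C wrap) f → γdR-path N ≤ weight f
  minus-wrap-bound f f-drdf = subst (γdR-path N ≤_) (sym weight≡) (γdR-path≤segment 0 m cut-0 cut-m)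
    where
    open DRDFOnSubgraphOfCycle m 2≤m (delete C wrap) (delete-⊆ C wrap) f f-drdf
    cut-0 : delete C wrap (vertex 0) (vertex (0 + m)) ≡ false
    cut-0 = delete-cut wrap (vertex 0) (vertex (0 + m)) wrap-left
    cut-m : delete C wrap (vertex m) (vertex (suc m)) ≡ false
    cut-m = delete-cut wrap (vertex m) (vertex (suc m)) wrap-right

  twoCuts : ℕ → Graph N
  twoCuts k = wrap ∪ edge k (suc k)

  module _ (k : ℕ) (k+1<m : suc k < m) where
    private
      k<N : k < N
      k<N = <-trans (<-trans (n<1+n k) k+1<m) (n<1+n m)

      k+1<N : suc k < N
      k+1<N = <-trans k+1<m (n<1+n m)

      wrap-disjoint : ∀ u v → wrap u v ≡ true → edge k (suc k) u v ≡ true → ⊥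
      wrap-disjoint u v e₁ e₂ with edge⇒Between 0 m u v e₁ | edge⇒Between k (suc k) u v e₂
      ... | inj₁ (_ , v≡m) | inj₁ (_ , v≡k+1) = <-irrefl (trans (sym v≡k+1) v≡m) k+1<m
      ... | inj₁ (_ , v≡m) | inj₂ (v≡k , _)   = <-irrefl (trans (sym v≡k) v≡m) (<-trans (n<1+n k) k+1<m)
      ... | inj₂ (_ , u≡m) | inj₁ (u≡k , _)   = <-irrefl (trans (sym u≡k) u≡m) (<-trans (n<1+n k) k+1<m)
      ... | inj₂ (_ , u≡m) | inj₂ (_ , u≡k+1) = <-irrefl (trans (sym u≡k+1) u≡m) k+1<m

    twoCuts-⊆C : IsEdgeSubset C (twoCuts k)
    twoCuts-⊆C = ∪-⊆ wrap-⊆C (edge-⊆C k (suc k) (adj-suc k))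

    card-twoCuts : card (twoCuts k) ≡ 2
    card-twoCuts = trans (card-∪ m wrap (edge k (suc k)) wrap-disjoint)
                     (cong₂ _+_ (card-edge m 0 m (≤-trans (s≤s z≤n) 2≤m) (n<1+n m)) (card-edge m k (suc k) (n<1+n k) k+1<N))

    two-cuts-bound : ∀ l → suc k + l ≡ m → ∀ f → IsDRDF (delete C (twoCuts k)) f →
                     γdR-path (suc k) + γdR-path (suc l) ≤ weight f
    two-cuts-bound l k+1+l≡m f f-drdf = subst (γdR-path (suc k) + γdR-path (suc l) ≤_) (sym weight-split)
      (+-mono-≤ (γdR-path≤segment 0 k cut-0 cut-k) (γdR-path≤segment (suc k) l cut-k+1 cut-m))
      where
      open DRDFOnSubgraphOfCycle m 2≤m (delete C (twoCuts k)) (delete-⊆ C (twoCuts k)) f f-drdf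
      G = delete C (twoCuts k)
      cut-wrap : ∀ u v → wrap u v ≡ true → G u v ≡ false
      cut-wrap u v e = delete-cut (twoCuts k) u v (∪-introˡ wrap (edge k (suc k)) u v e)
      cut-edge : ∀ u v → edge k (suc k) u v ≡ true → G u v ≡ false
      cut-edge u v e = delete-cut (twoCuts k) u v (∪-introʳ wrap (edge k (suc k)) u v e)
      cut-0 : G (vertex 0) (vertex (0 + m)) ≡ false
      cut-0 = cut-wrap (vertex 0) (vertex (0 + m)) wrap-left
      cut-k : G (vertex k) (vertex (suc k)) ≡ false
      cut-k = cut-edge (vertex k) (vertex (suc k))
                (Between⇒edge k (suc k) _ _ (inj₁ (toℕ-vertex-< k k<N , toℕ-vertex-< (suc k) k+1<N)))
      cut-k+1 : G (vertex (suc k)) (vertex (suc k + m)) ≡ false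
      cut-k+1 = cut-edge (vertex (suc k)) (vertex (suc k + m)) (Between⇒edge k (suc k) _ _
                  (inj₂ (trans (toℕ-vertex (suc k + m)) (trans (pred-suc k) (m<n⇒m%n≡m k<N)) , toℕ-vertex-< (suc k) k+1<N)))
      cut-m : G (vertex (suc k + l)) (vertex (suc (suc k + l))) ≡ false
      cut-m = cut-wrap (vertex (suc k + l)) (vertex (suc (suc k + l)))
                (subst (λ x → wrap (vertex x) (vertex (suc x)) ≡ true) (sym k+1+l≡m) wrap-right)
      weight-split : weight f ≡ sumTo (suc k) h + sumTo (suc l) (λ j → h (suc k + j))
      weight-split = trans weight≡ (trans (cong (λ n → sumTo n h) (trans (cong suc (sym k+1+l≡m)) (sym (+-suc (suc k) l))))
                       (sumTo-+ (suc k) (suc l) h))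

  bdR-one : N % 2 ≡ 0 → ¬ (N % 3 ≡ 0) → IsbdR C 1
  bdR-one even N%3≢0 = (wrap , wrap-⊆C , card-edge m 0 m (≤-trans (s≤s z≤n) 2≤m) (n<1+n m) , increases) , minimal
    where
    increases : Increases C wrap
    increases = increases-intro (γdR-C-even even)
      (λ f f-drdf → subst (_≤ weight f) (γdR-path-≢0 N N%3≢0) (minus-wrap-bound f f-drdf))
    minimal : ∀ B → IsEdgeSubset C B → Increases C B → 1 ≤ card B
    minimal B B⊆C inc = n≢0⇒n>0 (λ card≡0 → ¬increases-card0 B B⊆C card≡0 (γdR-C-even even) inc)

  bdR-two : N % 3 ≡ 0 ⊎ ¬ (N % 2 ≡ 0) → IsbdR C 2
  bdR-two cond =
    let (k , l , k+1+l≡m , k+1<m , exceeds) = split-exceeds m 2≤m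
    in (twoCuts k , twoCuts-⊆C k k+1<m , card-twoCuts k k+1<m ,
        increases-intro γC (λ f f-drdf → <-≤-trans exceeds (two-cuts-bound k k+1<m l k+1+l≡m f f-drdf))) ,
       minimal
    where
    γC = γdR-C-path cond
    minimal : ∀ B → IsEdgeSubset C B → Increases C B → 2 ≤ card B
    minimal B B⊆C inc with card B in card≡
    ... | zero        = ⊥-elim (¬increases-card0 B B⊆C card≡ γC inc)
    ... | suc zero    = ⊥-elim (¬increases-card1 B B⊆C card≡ γC inc)
    ... | suc (suc _) = s≤s (s≤s z≤n)

module _ (n : ℕ) where
  private
    %2-via-6 : n % 6 % 2 ≡ n % 2
    %2-via-6 = m∣n⇒o%n%m≡o%m 2 6 n (divides 3 refl)

    %3-via-6 : n % 6 % 3 ≡ n % 3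
    %3-via-6 = m∣n⇒o%n%m≡o%m 3 6 n (divides 2 refl)

  2-or-4-mod-6 : n % 6 ≡ 2 ⊎ n % 6 ≡ 4 → n % 2 ≡ 0 × ¬ (n % 3 ≡ 0)
  2-or-4-mod-6 (inj₁ n%6≡2) = trans (sym %2-via-6) (cong (_% 2) n%6≡2) ,
                              λ n%3≡0 → 0≢1+n (trans (sym n%3≡0) (trans (sym %3-via-6) (cong (_% 3) n%6≡2)))
  2-or-4-mod-6 (inj₂ n%6≡4) = trans (sym %2-via-6) (cong (_% 2) n%6≡4) ,
                              λ n%3≡0 → 0≢1+n (trans (sym n%3≡0) (trans (sym %3-via-6) (cong (_% 3) n%6≡4)))

  not-2-or-4-mod-6 : ¬ (n % 6 ≡ 2 ⊎ n % 6 ≡ 4) → n % 3 ≡ 0 ⊎ ¬ (n % 2 ≡ 0)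
  not-2-or-4-mod-6 ¬2-or-4 with n % 6 | m%n<n n 6 | %2-via-6 | %3-via-6
  ... | 0 | _ | _   | n%3 = inj₁ (sym n%3)
  ... | 1 | _ | n%2 | _   = inj₂ λ n%2≡0 → 0≢1+n (trans (sym n%2≡0) (sym n%2))
  ... | 2 | _ | _   | _   = ⊥-elim (¬2-or-4 (inj₁ refl))
  ... | 3 | _ | _   | n%3 = inj₁ (sym n%3)
  ... | 4 | _ | _   | _   = ⊥-elim (¬2-or-4 (inj₂ refl))
  ... | 5 | _ | n%2 | _   = inj₂ λ n%2≡0 → 0≢1+n (trans (sym n%2≡0) (sym n%2))
  ... | suc (suc (suc (suc (suc (suc _))))) | s≤s (s≤s (s≤s (s≤s (s≤s (s≤s ()))))) | _ | _

theorem2p2 : (n : ℕ) → 3 ≤ n →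
    ((n % 6 ≡ 2 ⊎ n % 6 ≡ 4) → IsbdR (cycle n) 1) ×
    (¬ (n % 6 ≡ 2 ⊎ n % 6 ≡ 4) → IsbdR (cycle n) 2)
theorem2p2 (suc m) (s≤s 2≤m) =
  (λ 2-or-4 → let (even , N%3≢0) = 2-or-4-mod-6 (suc m) 2-or-4 in bdR-one even N%3≢0) ,
  (λ ¬2-or-4 → bdR-two (not-2-or-4-mod-6 (suc m) ¬2-or-4))
  where open CycleBondage m 2≤m
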